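{- Let $q$ be a prime power, $\alpha$ a primitive element of $\mathbb{F}_q$, $k$ an integer with $2<k$, and $n=[k]_q\cdot(q+1)$ (so $k\le n-k$), $V=\mathbb{F}_q^n$. Let $w_1,\dots,w_{[k]_q}$ be the vectors of $\mathbb{F}_q^k$ whose first non-zero coordinate is $1$, listed in some order. Let $G_X$ be the $k\times n$ matrix $[X_1\,\cdots\,X_{[k]_q}]$, where each $X_i$ is the $k\times(q+1)$ matrix all of whose $q+1$ columns equal $w_i$ (as column vectors). Let $y=(0,1,\dots,1)\in\mathbb{F}_q^{q+1}$ and $z=(1,0,-1,-\alpha^{ -1},\dots,-\alpha^{ -(q-2)})\in\mathbb{F}_q^{q+1}$. Divide the $n$ columns into $[k]_q$ consecutive blocks of $q+1$ columns each, and let $G_Y$ be the $k\times n$ matrix whose rows, written blockwise, are: row $1$ has $y$ in block $1$ and $0$ elsewhere; for $2\le i\le k-2$, row $i$ has $z$ in block $i-1$, $y$ in block $i$, and $0$ elsewhere; row $k-1$ has $z$ in block $k-2$, $y$ in each of the blocks $k-1,k,\dots,[k]_q$, and $0$ elsewhere; row $k$ has $z$ in each of the blocks $k-1,k,\dots,[k]_q$ and $0$ elsewhere. If $X$ and $Y$ are the linear $[n,k]_q$ codes whose generator matrices (matrices whose rows form a basis of the code) are $G_X$ and $G_Y$, respectively, then $X,Y\in\mathcal{C}(n,k)_q$ and $$d(X,Y)=k\quad\text{and}\quad d_c(X,Y)=k+1.$$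
   Context: $\mathbb{F}_q$ is the finite field with $q$ elements. For $i=1,\dots,n$, $C_i=\{(x_1,\dots,x_n)\in V: x_i=0\}$. A non-degenerate linear $[n,k]_q$ code is a $k$-dimensional subspace of $V$ not contained in any $C_i$; $\mathcal{C}(n,k)_q$ is the set of all such codes. The Grassmann graph $\Gamma_k(V)$ has as vertices the $k$-dimensional subspaces of $V$, two adjacent iff their intersection is $(k-1)$-dimensional; its graph distance is $d(X,Y)=k-\dim(X\cap Y)$. $\Gamma(n,k)_q$ is the induced subgraph of $\Gamma_k(V)$ on $\mathcal{C}(n,k)_q$ (it is connected), and $d_c(X,Y)$ denotes the graph distance in $\Gamma(n,k)_q$. Notation: $[j]_q=\frac{q^j-1}{q-1}$. -}

module Defs where

open import Level using (0ℓ)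
open import Algebra.Bundles using (CommutativeRing)
open import Data.Nat as ℕ using (ℕ; zero; suc; _∸_; _<_; _≤_)
open import Data.Nat.Properties using (_≟_; _≤?_)
open import Data.Fin as Fin using (Fin; toℕ; remQuot)
open import Data.Product using (Σ; ∃; _×_; _,_; proj₁; proj₂)
open import Data.Bool using (if_then_else_)
open import Relation.Nullary using (¬_; Dec; does)
open import Relation.Binary.PropositionalEquality using (_≡_)
open import Function.Bundles using (_⇔_)

[_]_ : ℕ → ℕ → ℕ
[ zero ] q = 0
[ suc j ] q = 1 ℕ.+ q ℕ.* ([ j ] q)

record FiniteField (q : ℕ) : Set₁ where
  field
    commRing : CommutativeRing 0ℓ 0ℓ
  open CommutativeRing commRing public
  field
    _≈?_     : ∀ x y → Dec (x ≈ y)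
    0≉1      : ¬ (0# ≈ 1#)
    _⁻¹      : Carrier → Carrier
    ⁻¹-inv   : ∀ x → ¬ (x ≈ 0#) → x * (x ⁻¹) ≈ 1#
    enum     : Fin q → Carrier
    enum-inj : ∀ i j → enum i ≈ enum j → i ≡ j
    enum-sur : ∀ x → ∃ λ i → x ≈ enum i

module _ {q : ℕ} (F : FiniteField q) where
  open FiniteField F

  pow : Carrier → ℕ → Carrier
  pow x zero = 1#
  pow x (suc j) = x * pow x j

  IsPrimitive : Carrier → Set
  IsPrimitive α = ¬ (α ≈ 0#) × (∀ x → ¬ (x ≈ 0#) → ∃ λ j → x ≈ pow α j)

  Vect : ℕ → Set
  Vect n = Fin n → Carrier

  Σᶠ : ∀ {m} → (Fin m → Carrier) → Carrier
  Σᶠ {zero} f = 0#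
  Σᶠ {suc m} f = f Fin.zero + Σᶠ (λ i → f (Fin.suc i))

  lincomb : ∀ {m n} → (Fin m → Carrier) → (Fin m → Vect n) → Vect n
  lincomb c B j = Σᶠ (λ i → c i * B i j)

  InSpan : ∀ {m n} → (Fin m → Vect n) → Vect n → Set
  InSpan B v = ∃ λ c → ∀ j → v j ≈ lincomb c B j

  LinIndep : ∀ {m n} → (Fin m → Vect n) → Set
  LinIndep B = ∀ c → (∀ j → lincomb c B j ≈ 0#) → ∀ i → c i ≈ 0#

  Subset : ℕ → Set₁
  Subset n = Vect n → Set

  HasDim : ∀ {n} → Subset n → ℕ → Set
  HasDim {n} P m = Σ (Fin m → Vect n) λ B → LinIndep B × (∀ v → P v ⇔ InSpan B v)

  _∩_ : ∀ {n} → Subset n → Subset n → Subset n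
  (X ∩ Y) v = X v × Y v

  SameSubspace : ∀ {n} → Subset n → Subset n → Set
  SameSubspace X Y = ∀ v → X v ⇔ Y v

  RowSpace : ∀ {k n} → (Fin k → Vect n) → Subset n
  RowSpace G = InSpan G

  NonDegenerate : ∀ {n} → Subset n → Set
  NonDegenerate {n} X = ∀ (i : Fin n) → ∃ λ v → X v × ¬ (v i ≈ 0#)

  -- X ∈ 𝒞(n,k)_q : a non-degenerate linear [n,k]_q code
  IsCode : ∀ {n} → ℕ → Subset n → Set
  IsCode k X = HasDim X k × NonDegenerate X

  GrassDist : ∀ {n} → ℕ → Subset n → Subset n → ℕ → Set
  GrassDist k X Y d = Σ ℕ λ m → HasDim (X ∩ Y) m × (d ℕ.+ m ≡ k)

  -- adjacency in Γ_k(V) (both arguments k-dimensional): dim(X ∩ Y) = k-1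
  Adjacent : ∀ {n} → ℕ → Subset n → Subset n → Set
  Adjacent k X Y = HasDim (X ∩ Y) (k ∸ 1)

  -- walks of length ℓ in Γ(n,k)_q from X to Y (X assumed to be a code;
  -- every subsequent vertex is required to be a code)
  data CodeWalk {n : ℕ} (k : ℕ) : Subset n → Subset n → ℕ → Set₁ where
    stop : ∀ {X Y} → SameSubspace X Y → CodeWalk k X Y 0
    step : ∀ {X Z Y ℓ} → IsCode k Z → Adjacent k X Z → CodeWalk k Z Y ℓ →
           CodeWalk k X Y (suc ℓ)

  CodeDist : ∀ {n} → ℕ → Subset n → Subset n → ℕ → Set₁
  CodeDist k X Y d = CodeWalk k X Y d × (∀ ℓ → ℓ < d → ¬ CodeWalk k X Y ℓ)

  FirstNonzeroOne : ∀ {k} → Vect k → Set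
  FirstNonzeroOne {k} v = ∃ λ (t : Fin k) → (∀ s → toℕ s < toℕ t → v s ≈ 0#) × (v t ≈ 1#)

  IsListing : ∀ k → (Fin ([ k ] q) → Vect k) → Set
  IsListing k w = (∀ i → FirstNonzeroOne (w i))
                × (∀ i j → (∀ s → w i s ≈ w j s) → i ≡ j)
                × (∀ v → FirstNonzeroOne v → ∃ λ i → ∀ s → v s ≈ w i s)

  yvec : Vect (suc q)
  yvec p with toℕ p
  ... | zero = 0#
  ... | suc _ = 1#

  zvec : Carrier → Vect (suc q)
  zvec α p with toℕ p
  ... | zero = 1#
  ... | suc zero = 0#
  ... | suc (suc j) = - pow (α ⁻¹) j

  GX : ∀ k → (Fin ([ k ] q) → Vect k) → Fin k → Vect ([ k ] q ℕ.* suc q)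
  GX k w r j = w (proj₁ (remQuot (suc q) j)) r

  -- G_Y, with 0-indexed rows r and blocks b (paper's row r+1, block b+1)
  GYentry : ℕ → Carrier → ℕ → ℕ → Fin (suc q) → Carrier
  GYentry k α r b p =
    if does (r ≟ k ∸ 1) then
      (if does (k ∸ 2 ≤? b) then zvec α p else 0#)
    else if does (r ≟ k ∸ 2) then
      (if does (b ≟ k ∸ 3) then zvec α p
       else if does (k ∸ 2 ≤? b) then yvec p else 0#)
    else if does (r ≟ 0) then
      (if does (b ≟ 0) then yvec p else 0#)
    else
      (if does (suc b ≟ r) then zvec α p
       else if does (b ≟ r) then yvec p else 0#)

  GY : ∀ k → Carrier → Fin k → Vect ([ k ] q ℕ.* suc q)
  GY k α r j = GYentry k α (toℕ r) (toℕ (proj₁ bp)) (proj₂ bp)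
    where bp = remQuot {[ k ] q} (suc q) j

-- The rows x₁, …, x_k of G_X, the all-one vector 1 and the rows y₁, …, y_k of G_Y are linearly
-- independent: on a block, a combination of them reads (⟨a, w_b⟩ + c)·1 + dᵢ·y + dᵢ₊₁·z, and 1, y, z are
-- independent in F_q^(q+1). Hence X ∩ Y = 0, and sliding a window of k consecutive vectors along
-- x₁, …, x_k, 1, y₁, …, y_k is a walk of length k+1 from X to Y whose inner vertices contain 1.
-- Conversely, each step of a walk lowers dim (Z ∩ Y) by at most one, so a walk X, Z₁, …, Y of length at
-- most k forces Z₁ ∩ Y ≠ 0. But a code Z₁ adjacent to X meets Y trivially: the k coordinate columns of
-- X ∩ Z₁ lie in F_q^(k-1), and a dependency, normalised to a listed w_b, shows that X ∩ Z₁ vanishes on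
-- block b; since α is primitive the coordinates of (y, z) cover the projective line, so every vector of
-- Y has a zero in block b; and a non-zero vector of Z₁ ∩ Y together with X ∩ Z₁ would span Z₁, which
-- would then be degenerate.

module Submission where

open import Defs
import Algebra.Properties.CommutativeSemigroup as CommutativeSemigroupProperties
import Algebra.Properties.Group as GroupProperties
import Algebra.Properties.Ring as RingProperties
import Algebra.Properties.Semiring.Sum as SemiringSum
open import Data.Empty using (⊥; ⊥-elim)
open import Data.Unit using (⊤; tt)
open import Effect.Monad using (RawMonad)
open import Level using (0ℓ)
open import Data.Nat as ℕ using (ℕ; zero; suc; _<_; _≤_; _∸_; z≤n; s≤s)
import Data.Nat.Properties as ℕₚ
open import Data.Fin as Fin using (Fin; zero; suc; toℕ; inject₁; punchIn; _↑ˡ_; _↑ʳ_)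
import Data.Fin.Properties as Finₚ
open import Data.Bool using (if_then_else_)
open import Data.Product using (Σ; ∃; _×_; _,_; proj₁; proj₂)
open import Data.Sum using (inj₁; inj₂; [_,_]′)
open import Data.Vec.Functional using (_∷_; insertAt)
open import Data.Vec.Functional.Properties using (insertAt-lookup; insertAt-punchIn)
open import Function using (_∘_; mk⇔; Equivalence)
import Function.Properties.Equivalence as ⇔
open import Relation.Nullary using (¬_; Dec; yes; no; does; ¬?)
open import Relation.Nullary.Negation using (¬¬-Monad)
open import Relation.Nullary.Decidable using (dec-true; dec-false; decidable-stable)
open import Relation.Binary.PropositionalEquality as ≡ using (_≡_; _≢_)

prepend : ∀ {A : Set} {m} → (Fin m → A) → (ℕ → A) → ℕ → A
prepend {m = zero} v s t = s t
prepend {m = suc m} v s zero = v zero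
prepend {m = suc m} v s (suc t) = prepend (v ∘ suc) s t

prepend-toℕ : ∀ {A : Set} {m} (v : Fin m → A) s i → prepend v s (toℕ i) ≡ v i
prepend-toℕ v s zero = ≡.refl
prepend-toℕ v s (suc i) = prepend-toℕ (v ∘ suc) s i

prepend-+ : ∀ {A : Set} {m} (v : Fin m → A) s t → prepend v s (m ℕ.+ t) ≡ s t
prepend-+ {m = zero} v s t = ≡.refl
prepend-+ {m = suc m} v s t = prepend-+ (v ∘ suc) s t

↑-cases : ∀ {m n} {P : Fin (m ℕ.+ n) → Set} → (∀ i → P (i ↑ˡ n)) → (∀ j → P (m ↑ʳ j)) → ∀ i → P i
↑-cases {m} {n} {P} left right i with Fin.splitAt m i in eq
... | inj₁ i' = ≡.subst P (Finₚ.splitAt⁻¹-↑ˡ eq) (left i')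
... | inj₂ j = ≡.subst P (Finₚ.splitAt⁻¹-↑ʳ eq) (right j)

module LinearAlgebra {q : ℕ} (F : FiniteField q) where

  open FiniteField F hiding (zero)
  open import Relation.Binary.Reasoning.Setoid setoid public hiding (stop)
  private
    module +G = GroupProperties +-group
  open RingProperties ring public
    using (-‿distribˡ-*; -‿distribʳ-*; x[y-z]≈xy-xz)
  open RawMonad (¬¬-Monad {0ℓ}) using (pure; _>>=_)
  open SemiringSum semiring using (sum; sum-remove; ∑-distrib-+; *-distribˡ-sum)

  x-x≈0 : ∀ x → x - x ≈ 0#
  x-x≈0 = -‿inverseʳ

  x-y≈0⇒x≈y : ∀ {x y} → x - y ≈ 0# → x ≈ y
  x-y≈0⇒x≈y = +G.x∙y⁻¹≈ε⇒x≈y _ _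

  x≈y⇒x-y≈0 : ∀ {x y} → x ≈ y → x - y ≈ 0#
  x≈y⇒x-y≈0 = +G.x≈y⇒x∙y⁻¹≈ε

  x+y≈0⇒x≈-y : ∀ {x y} → x + y ≈ 0# → x ≈ - y
  x+y≈0⇒x≈-y = +G.inverseˡ-unique _ _

  -0≈0 : - 0# ≈ 0#
  -0≈0 = +G.ε⁻¹≈ε

  -x≈0⇒x≈0 : ∀ {x} → - x ≈ 0# → x ≈ 0#
  -x≈0⇒x≈0 {x} p = trans (sym (+G.⁻¹-involutive x)) (trans (-‿cong p) -0≈0)

  1≉0 : ¬ 1# ≈ 0#
  1≉0 p = 0≉1 (sym p)

  ⁻¹-inverseˡ : ∀ {x} → ¬ x ≈ 0# → x ⁻¹ * x ≈ 1#
  ⁻¹-inverseˡ {x} x≉0 = trans (*-comm _ _) (⁻¹-inv x x≉0)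

  ⁻¹-≉0 : ∀ {x} → ¬ x ≈ 0# → ¬ x ⁻¹ ≈ 0#
  ⁻¹-≉0 {x} x≉0 p = 0≉1 (begin
    0#         ≈⟨ sym (zeroʳ x) ⟩
    x * 0#     ≈⟨ *-cong refl p ⟨
    x * x ⁻¹   ≈⟨ ⁻¹-inv x x≉0 ⟩
    1#         ∎)

  x/y*y≈x : ∀ x {y} → ¬ y ≈ 0# → (x * y ⁻¹) * y ≈ x
  x/y*y≈x x {y} y≉0 = trans (*-assoc x _ y) (trans (*-cong refl (⁻¹-inverseˡ y≉0)) (*-identityʳ x))

  *-cancelˡ-≈0 : ∀ {x y} → ¬ x ≈ 0# → x * y ≈ 0# → y ≈ 0#
  *-cancelˡ-≈0 {x} {y} x≉0 p = begin
    y                ≈⟨ *-identityˡ y ⟨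
    1# * y           ≈⟨ *-cong (⁻¹-inverseˡ x≉0) refl ⟨
    (x ⁻¹ * x) * y   ≈⟨ *-assoc _ _ _ ⟩
    x ⁻¹ * (x * y)   ≈⟨ *-cong refl p ⟩
    x ⁻¹ * 0#        ≈⟨ zeroʳ _ ⟩
    0#               ∎

  x≉0∧y≉0⇒xy≉0 : ∀ {x y} → ¬ x ≈ 0# → ¬ y ≈ 0# → ¬ x * y ≈ 0#
  x≉0∧y≉0⇒xy≉0 x≉0 y≉0 p = y≉0 (*-cancelˡ-≈0 x≉0 p)

  *-cancelˡ : ∀ {a x y} → ¬ a ≈ 0# → a * x ≈ a * y → x ≈ y
  *-cancelˡ {a} a≉0 p = x-y≈0⇒x≈y (*-cancelˡ-≈0 a≉0 (trans (x[y-z]≈xy-xz a _ _) (x≈y⇒x-y≈0 p)))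

  -- Dot products: lincomb F c B j is definitionally c · (column j of B)

  infix 7 _·_
  _·_ : ∀ {m} → Vect F m → Vect F m → Carrier
  a · v = Σᶠ F (λ i → a i * v i)

  Σᶠ≈sum : ∀ {m} (f : Fin m → Carrier) → Σᶠ F f ≈ sum f
  Σᶠ≈sum {zero} f = refl
  Σᶠ≈sum {suc m} f = +-cong refl (Σᶠ≈sum (f ∘ suc))

  Σᶠ-cong : ∀ {m} {f g : Fin m → Carrier} → (∀ i → f i ≈ g i) → Σᶠ F f ≈ Σᶠ F g
  Σᶠ-cong {zero} e = refl
  Σᶠ-cong {suc m} e = +-cong (e zero) (Σᶠ-cong (e ∘ suc))

  Σᶠ-zero : ∀ {m} {f : Fin m → Carrier} → (∀ i → f i ≈ 0#) → Σᶠ F f ≈ 0#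
  Σᶠ-zero {zero} e = refl
  Σᶠ-zero {suc m} e = trans (+-cong (e zero) (Σᶠ-zero (e ∘ suc))) (+-identityʳ 0#)

  Σᶠ-single : ∀ {m} (f : Fin m → Carrier) i → (∀ j → j ≢ i → f j ≈ 0#) → Σᶠ F f ≈ f i
  Σᶠ-single f zero e =
    trans (+-cong refl (Σᶠ-zero (λ j → e (suc j) λ ()))) (+-identityʳ _)
  Σᶠ-single f (suc i) e =
    trans (+-cong (e zero λ ()) (Σᶠ-single (f ∘ suc) i (λ j j≢i → e (suc j) (j≢i ∘ Finₚ.suc-injective))))
          (+-identityˡ _)

  ·-congˡ : ∀ {m} {a a' : Vect F m} → (∀ i → a i ≈ a' i) → ∀ v → a · v ≈ a' · v
  ·-congˡ a≈a' v = Σᶠ-cong (λ i → *-cong (a≈a' i) refl)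

  ·-congʳ : ∀ {m} (a : Vect F m) {v v'} → (∀ i → v i ≈ v' i) → a · v ≈ a · v'
  ·-congʳ a v≈v' = Σᶠ-cong (λ i → *-cong refl (v≈v' i))

  ·-zeroˡ : ∀ {m} {a : Vect F m} (v : Vect F m) → (∀ i → a i ≈ 0#) → a · v ≈ 0#
  ·-zeroˡ v e = Σᶠ-zero (λ i → trans (*-cong (e i) refl) (zeroˡ (v i)))

  ·-zeroʳ : ∀ {m} (a : Vect F m) {v : Vect F m} → (∀ i → v i ≈ 0#) → a · v ≈ 0#
  ·-zeroʳ a e = Σᶠ-zero (λ i → trans (*-cong refl (e i)) (zeroʳ (a i)))

  ·-comm : ∀ {m} (a v : Vect F m) → a · v ≈ v · a
  ·-comm a v = Σᶠ-cong (λ i → *-comm (a i) (v i))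

  ·-distribʳ-+ : ∀ {m} (a b v : Vect F m) → (λ i → a i + b i) · v ≈ a · v + b · v
  ·-distribʳ-+ a b v = begin
    (λ i → a i + b i) · v               ≈⟨ Σᶠ-cong (λ i → distribʳ (v i) (a i) (b i)) ⟩
    Σᶠ F (λ i → a i * v i + b i * v i)  ≈⟨ Σᶠ≈sum (λ i → a i * v i + b i * v i) ⟩
    sum (λ i → a i * v i + b i * v i)   ≈⟨ ∑-distrib-+ (λ i → a i * v i) (λ i → b i * v i) ⟩
    sum (λ i → a i * v i) + sum (λ i → b i * v i)
      ≈⟨ +-cong (Σᶠ≈sum (λ i → a i * v i)) (Σᶠ≈sum (λ i → b i * v i)) ⟨
    a · v + b · v                       ∎

  ·-scaleˡ : ∀ {m} μ (a v : Vect F m) → (λ i → μ * a i) · v ≈ μ * (a · v)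
  ·-scaleˡ μ a v = begin
    (λ i → μ * a i) · v          ≈⟨ Σᶠ-cong (λ i → *-assoc μ (a i) (v i)) ⟩
    Σᶠ F (λ i → μ * (a i * v i)) ≈⟨ Σᶠ≈sum (λ i → μ * (a i * v i)) ⟩
    sum (λ i → μ * (a i * v i))  ≈⟨ *-distribˡ-sum μ (λ i → a i * v i) ⟨
    μ * sum (λ i → a i * v i)    ≈⟨ *-cong refl (Σᶠ≈sum (λ i → a i * v i)) ⟨
    μ * (a · v)                  ∎

  ·-negˡ : ∀ {m} (a v : Vect F m) → (λ i → - a i) · v ≈ - (a · v)
  ·-negˡ a v = begin
    (λ i → - a i) · v          ≈⟨ Σᶠ-cong (λ i → *-cong (sym (-1*x≈-x (a i))) refl) ⟩
    (λ i → - 1# * a i) · v     ≈⟨ ·-scaleˡ (- 1#) a v ⟩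
    - 1# * (a · v)             ≈⟨ -1*x≈-x _ ⟩
    - (a · v)                  ∎
    where open RingProperties ring using (-1*x≈-x)

  ·-distribʳ-- : ∀ {m} (a b v : Vect F m) → (λ i → a i - b i) · v ≈ a · v - b · v
  ·-distribʳ-- a b v = trans (·-distribʳ-+ a (λ i → - b i) v) (+-cong refl (·-negˡ b v))

  ·-distribˡ-+ : ∀ {m} (a u v : Vect F m) → a · (λ i → u i + v i) ≈ a · u + a · v
  ·-distribˡ-+ a u v = trans (·-comm a _) (trans (·-distribʳ-+ u v a) (+-cong (·-comm u a) (·-comm v a)))

  ·-scaleʳ : ∀ {m} (a v : Vect F m) μ → a · (λ i → v i * μ) ≈ (a · v) * μ
  ·-scaleʳ a v μ = begin
    a · (λ i → v i * μ)  ≈⟨ ·-comm a _ ⟩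
    (λ i → v i * μ) · a  ≈⟨ ·-congˡ (λ i → *-comm (v i) μ) a ⟩
    (λ i → μ * v i) · a  ≈⟨ ·-scaleˡ μ v a ⟩
    μ * (v · a)          ≈⟨ *-comm μ _ ⟩
    (v · a) * μ          ≈⟨ *-cong (·-comm v a) refl ⟩
    (a · v) * μ          ∎

  ·-subˡ : ∀ {m} μ (a b v : Vect F m) → (λ i → a i - μ * b i) · v ≈ a · v - μ * (b · v)
  ·-subˡ μ a b v = begin
    (λ i → a i - μ * b i) · v              ≈⟨ ·-distribʳ-+ a (λ i → - (μ * b i)) v ⟩
    a · v + (λ i → - (μ * b i)) · v        ≈⟨ +-cong refl (·-negˡ (λ i → μ * b i) v) ⟩
    a · v - (λ i → μ * b i) · v            ≈⟨ +-cong refl (-‿cong (·-scaleˡ μ b v)) ⟩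
    a · v - μ * (b · v)                    ∎

  ·-split : ∀ m {n} (a v : Vect F (m ℕ.+ n)) →
            a · v ≈ (a ∘ (_↑ˡ n)) · (v ∘ (_↑ˡ n)) + (a ∘ (m ↑ʳ_)) · (v ∘ (m ↑ʳ_))
  ·-split zero a v = sym (+-identityˡ _)
  ·-split (suc m) a v = trans (+-cong refl (·-split m (a ∘ suc) (v ∘ suc))) (sym (+-assoc _ _ _))

  ·-remove : ∀ {m} (a v : Vect F (suc m)) i → a · v ≈ a i * v i + (a ∘ punchIn i) · (v ∘ punchIn i)
  ·-remove a v i = begin
    a · v                                       ≈⟨ Σᶠ≈sum (λ j → a j * v j) ⟩
    sum (λ j → a j * v j)                       ≈⟨ sum-remove (λ j → a j * v j) ⟩
    a i * v i + sum (λ j → a (punchIn i j) * v (punchIn i j))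
      ≈⟨ +-cong refl (Σᶠ≈sum (λ j → a (punchIn i j) * v (punchIn i j))) ⟨
    a i * v i + (a ∘ punchIn i) · (v ∘ punchIn i) ∎

  ·-subʳ : ∀ {m} (a x μ : Vect F m) y → a · (λ i → x i - μ i * y) ≈ a · x - (a · μ) * y
  ·-subʳ a x μ y = begin
    a · (λ i → x i - μ i * y)  ≈⟨ ·-comm a _ ⟩
    (λ i → x i - μ i * y) · a  ≈⟨ ·-congˡ (λ i → +-cong refl (-‿cong (*-comm (μ i) y))) a ⟩
    (λ i → x i - y * μ i) · a  ≈⟨ ·-subˡ y x μ a ⟩
    x · a - y * (μ · a)        ≈⟨ +-cong (·-comm x a) (-‿cong (trans (*-comm y _) (*-cong (·-comm μ a) refl))) ⟩
    a · x - (a · μ) * y        ∎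

  𝟙[_≡_] : ℕ → ℕ → Carrier
  𝟙[ m ≡ n ] = if does (m ℕ.≟ n) then 1# else 0#

  𝟙-refl : ∀ m → 𝟙[ m ≡ m ] ≈ 1#
  𝟙-refl m rewrite dec-true (m ℕ.≟ m) ≡.refl = refl

  𝟙-≢ : ∀ {m n} → m ≢ n → 𝟙[ m ≡ n ] ≈ 0#
  𝟙-≢ {m} {n} m≢n rewrite dec-false (m ℕ.≟ n) m≢n = refl

  δ : ∀ {m} → Fin m → Vect F m
  δ i j = 𝟙[ toℕ i ≡ toℕ j ]

  δ-diag : ∀ {m} (i : Fin m) → δ i i ≈ 1#
  δ-diag i = 𝟙-refl (toℕ i)

  δ-off : ∀ {m} {i j : Fin m} → i ≢ j → δ i j ≈ 0#
  δ-off i≢j = 𝟙-≢ (i≢j ∘ Finₚ.toℕ-injective)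

  ·-δ : ∀ {m} (a : Vect F m) i → a · δ i ≈ a i
  ·-δ a i = begin
    a · δ i     ≈⟨ Σᶠ-single _ i (λ j j≢i → trans (*-cong refl (δ-off (j≢i ∘ ≡.sym))) (zeroʳ (a j))) ⟩
    a i * δ i i ≈⟨ *-cong refl (δ-diag i) ⟩
    a i * 1#    ≈⟨ *-identityʳ (a i) ⟩
    a i         ∎

  δ-· : ∀ {m} i (v : Vect F m) → δ i · v ≈ v i
  δ-· i v = trans (·-comm (δ i) v) (·-δ v i)

  δ-sym : ∀ {m} (i j : Fin m) → δ i j ≈ δ j i
  δ-sym i j with i Fin.≟ j
  ... | yes ≡.refl = refl
  ... | no i≢j = trans (δ-off i≢j) (sym (δ-off (i≢j ∘ ≡.sym)))

  InSpan-standard : ∀ {m} (x : Vect F m) → InSpan F δ x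
  InSpan-standard x = x , λ j → sym (trans (·-congʳ x (λ i → δ-sym i j)) (·-δ x j))

  first-nonzero : ∀ {m} (c : Vect F m) → (∃ λ r → ¬ c r ≈ 0#) →
                  ∃ λ t → (∀ s → toℕ s < toℕ t → c s ≈ 0#) × ¬ c t ≈ 0#
  first-nonzero c (zero , c₀≉0) = zero , (λ _ ()) , c₀≉0
  first-nonzero c (suc r , cᵣ≉0) with c zero ≈? 0#
  ... | no c₀≉0 = zero , (λ _ ()) , c₀≉0
  ... | yes c₀≈0 =
    let (t , before-t , cₜ≉0) = first-nonzero (c ∘ suc) (r , cᵣ≉0)
    in suc t , (λ { zero _ → c₀≈0 ; (suc s) s<t → before-t s (ℕₚ.≤-pred s<t) }) , cₜ≉0

  padLast : ∀ {n} → Vect F n → Vect F (suc n)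
  padLast {zero} a _ = 0#
  padLast {suc n} a = a zero ∷ padLast (a ∘ suc)

  padLast-inject₁ : ∀ {n} (a : Vect F n) i → padLast a (inject₁ i) ≡ a i
  padLast-inject₁ a zero = ≡.refl
  padLast-inject₁ a (suc i) = padLast-inject₁ (a ∘ suc) i

  ·-padLast : ∀ {n} (a : Vect F n) (v : Vect F (suc n)) → padLast a · v ≈ a · (v ∘ inject₁)
  ·-padLast {zero} a v = trans (+-identityʳ _) (zeroˡ (v zero))
  ·-padLast {suc n} a v = +-cong refl (·-padLast (a ∘ suc) (v ∘ suc))

  module _ {m n : ℕ} where

    InSpan-basis : (B : Fin m → Vect F n) (i : Fin m) → InSpan F B (B i)
    InSpan-basis B i = δ i , λ j → sym (δ-· i (λ r → B r j))

    InSpan-≈0 : (B : Fin m → Vect F n) {v : Vect F n} → (∀ j → v j ≈ 0#) → InSpan F B v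
    InSpan-≈0 B v≈0 = (λ _ → 0#) , λ j → trans (v≈0 j) (sym (·-zeroˡ (λ r → B r j) (λ _ → refl)))

    InSpan-sub : {B : Fin m → Vect F n} {u v : Vect F n} (μ : Carrier) →
                 InSpan F B u → InSpan F B v → InSpan F B (λ j → u j - μ * v j)
    InSpan-sub {B} μ (c , u≈cB) (d , v≈dB) =
      (λ i → c i - μ * d i) ,
      λ j → trans (+-cong (u≈cB j) (-‿cong (*-cong refl (v≈dB j)))) (sym (·-subˡ μ c d (λ r → B r j)))

    InSpan-resp : {B B' : Fin m → Vect F n} → (∀ i j → B i j ≈ B' i j) →
                    ∀ v → InSpan F B v → InSpan F B' v
    InSpan-resp B≈B' v (c , v≈cB) = c , λ j → trans (v≈cB j) (·-congʳ c (λ i → B≈B' i j))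

    span-resp : {B B' : Fin m → Vect F n} → (∀ i j → B i j ≈ B' i j) →
                  SameSubspace F (InSpan F B) (InSpan F B')
    span-resp B≈B' v = mk⇔ (InSpan-resp B≈B' v) (InSpan-resp (λ i j → sym (B≈B' i j)) v)

    LinIndep-resp : {B B' : Fin m → Vect F n} → (∀ i j → B i j ≈ B' i j) →
                    LinIndep F B → LinIndep F B'
    LinIndep-resp B≈B' ind c cB'≈0 = ind c (λ j → trans (·-congʳ c (λ i → B≈B' i j)) (cB'≈0 j))

    LinIndep⇒≉0 : {B : Fin m → Vect F n} → LinIndep F B → ∀ i → ¬ (∀ j → B i j ≈ 0#)
    LinIndep⇒≉0 {B} ind i Bi≈0 =
      1≉0 (trans (sym (δ-diag i)) (ind (δ i) (λ j → trans (δ-· i (λ r → B r j)) (Bi≈0 j)) i))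

  module _ {p n : ℕ} {v : Fin (suc p) → Vect F n} where

    LinIndep-tail : LinIndep F v → LinIndep F (v ∘ suc)
    LinIndep-tail ind c cv≈0 i =
      ind (0# ∷ c) (λ j → trans (+-cong (zeroˡ _) (cv≈0 j)) (+-identityʳ 0#)) (suc i)

    LinIndep-init : LinIndep F v → LinIndep F (v ∘ inject₁)
    LinIndep-init ind c cv≈0 i = ≡.subst (_≈ 0#) (padLast-inject₁ c i)
      (ind (padLast c) (λ j → trans (·-padLast c (λ r → v r j)) (cv≈0 j)) (inject₁ i))

    LinIndep-eliminate : LinIndep F v → ∀ i₀ (μ : Fin p → Carrier) →
                         LinIndep F (λ i j → v (punchIn i₀ i) j - μ i * v i₀ j)
    LinIndep-eliminate ind i₀ μ c cu≈0 i = ≡.subst (_≈ 0#) (insertAt-punchIn c i₀ a i)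
      (ind d dv≈0 (punchIn i₀ i))
      where
      a = - (c · μ)
      d = insertAt c i₀ a
      dv≈0 : ∀ j → lincomb F d v j ≈ 0#
      dv≈0 j = begin
        d · (λ r → v r j)
          ≈⟨ ·-remove d (λ r → v r j) i₀ ⟩
        d i₀ * v i₀ j + (d ∘ punchIn i₀) · (λ i → v (punchIn i₀ i) j)
          ≈⟨ +-cong (*-cong (reflexive (insertAt-lookup c i₀ a)) refl)
                    (·-congˡ (λ i → reflexive (insertAt-punchIn c i₀ a i)) _) ⟩
        a * v i₀ j + c · (λ i → v (punchIn i₀ i) j)
          ≈⟨ +-comm _ _ ⟩
        c · (λ i → v (punchIn i₀ i) j) + - (c · μ) * v i₀ j
          ≈⟨ +-cong refl (sym (-‿distribˡ-* _ _)) ⟩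
        c · (λ i → v (punchIn i₀ i) j) - (c · μ) * v i₀ j
          ≈⟨ ·-subʳ c (λ i → v (punchIn i₀ i) j) μ (v i₀ j) ⟨
        lincomb F c (λ i j → v (punchIn i₀ i) j - μ i * v i₀ j) j
          ≈⟨ cu≈0 j ⟩
        0# ∎

  module _ {p n : ℕ} {v : Fin p → Vect F n} where

    LinIndep-∷ : ∀ {u} → LinIndep F v → ¬ InSpan F v u → LinIndep F (u ∷ v)
    LinIndep-∷ {u} ind u∉v c c[u∷v]≈0 with c zero ≈? 0#
    ... | yes c₀≈0 = λ where
      zero    → c₀≈0
      (suc i) → ind (c ∘ suc) (λ j → trans (sym (+-identityˡ _))
                  (trans (+-cong (sym (trans (*-cong c₀≈0 refl) (zeroˡ (u j)))) refl) (c[u∷v]≈0 j))) i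
    ... | no c₀≉0 = ⊥-elim (u∉v ((λ i → κ * c (suc i)) , u≈))
      where
      κ = - (c zero ⁻¹)
      u≈ : ∀ j → u j ≈ lincomb F (λ i → κ * c (suc i)) v j
      u≈ j = begin
        u j                              ≈⟨ *-identityˡ (u j) ⟨
        1# * u j                         ≈⟨ *-cong (⁻¹-inverseˡ c₀≉0) refl ⟨
        (c zero ⁻¹ * c zero) * u j       ≈⟨ *-assoc _ _ _ ⟩
        c zero ⁻¹ * (c zero * u j)       ≈⟨ *-cong refl (x+y≈0⇒x≈-y (c[u∷v]≈0 j)) ⟩
        c zero ⁻¹ * - lincomb F (c ∘ suc) v j ≈⟨ -‿distribʳ-* _ _ ⟨
        - (c zero ⁻¹ * lincomb F (c ∘ suc) v j) ≈⟨ -‿distribˡ-* _ _ ⟩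
        κ * lincomb F (c ∘ suc) v j      ≈⟨ ·-scaleˡ κ (c ∘ suc) (λ i → v i j) ⟨
        lincomb F (λ i → κ * c (suc i)) v j ∎

  module _ {m n : ℕ} {b : Fin (suc m) → Vect F n} where

    InSpan-tail : ∀ {x : Vect F n} (a : Vect F (suc m)) → (∀ j → x j ≈ lincomb F a b j) →
                  a zero ≈ 0# → InSpan F (b ∘ suc) x
    InSpan-tail a x≈ab a₀≈0 =
      a ∘ suc , λ j → trans (x≈ab j) (trans (+-cong (trans (*-cong a₀≈0 refl) (zeroˡ _)) refl) (+-identityˡ _))

    InSpan-eliminate : ∀ {x y : Vect F n} (a c : Vect F (suc m)) μ →
                       (∀ j → x j ≈ lincomb F a b j) → (∀ j → y j ≈ lincomb F c b j) →
                       a zero ≈ μ * c zero → InSpan F (b ∘ suc) (λ j → x j - μ * y j)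
    InSpan-eliminate a c μ x≈ab y≈cb a₀≈μc₀ =
      InSpan-tail (λ i → a i - μ * c i)
        (λ j → trans (+-cong (x≈ab j) (-‿cong (*-cong refl (y≈cb j)))) (sym (·-subˡ μ a c (λ i → b i j))))
        (x≈y⇒x-y≈0 a₀≈μc₀)

  -- Rank bounds along walks

  Rank≥ : ∀ {n} → Subset F n → ℕ → Set
  Rank≥ {n} P r = Σ (Fin r → Vect F n) λ B → LinIndep F B × (∀ i → P (B i))

  SubtractionClosed : ∀ {n} → Subset F n → Set
  SubtractionClosed Y = ∀ μ {u v} → Y u → Y v → Y (λ j → u j - μ * v j)

  -- Gaussian elimination of the u-coordinate costs at most one independent vector.
  rank-drop : ∀ {k m n} {Y : Subset F n} → SubtractionClosed Y → {u : Vect F n} {h : Fin k → Vect F n}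
              (w : Fin (suc m) → Vect F n) → LinIndep F w → (∀ i → Y (w i)) →
              (∀ i → InSpan F (u ∷ h) (w i)) → Rank≥ (_∩_ F (InSpan F h) Y) m
  rank-drop {Y = Y} closed {u} {h} w w-indep w∈Y w∈uh = by-pivot (Finₚ.any? (λ i → ¬? (coeff i zero ≈? 0#)))
    where
    coeff : Fin _ → Vect F (suc _)
    coeff i = proj₁ (w∈uh i)
    by-pivot : Dec (∃ λ i → ¬ coeff i zero ≈ 0#) → Rank≥ (_∩_ F (InSpan F h) Y) _
    by-pivot (no none) =
      w ∘ suc , LinIndep-tail {v = w} w-indep ,
      λ i → InSpan-tail {b = u ∷ h} (coeff (suc i)) (proj₂ (w∈uh (suc i)))
              (decidable-stable (coeff (suc i) zero ≈? 0#) (λ c≉0 → none (suc i , c≉0))) ,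
            w∈Y (suc i)
    by-pivot (yes (i₀ , c≉0)) =
      _ , LinIndep-eliminate {v = w} w-indep i₀ μ ,
      λ i → InSpan-eliminate {b = u ∷ h} (coeff (punchIn i₀ i)) (coeff i₀) (μ i)
              (proj₂ (w∈uh (punchIn i₀ i))) (proj₂ (w∈uh i₀)) (sym (x/y*y≈x _ c≉0)) ,
            closed (μ i) (w∈Y (punchIn i₀ i)) (w∈Y i₀)
      where
      μ : Fin _ → Carrier
      μ i = coeff (punchIn i₀ i) zero * coeff i₀ zero ⁻¹

  steinitz : ∀ {m p n} → m < p → (v : Fin p → Vect F n) (b : Fin m → Vect F n) →
             LinIndep F v → (∀ i → InSpan F b (v i)) → ⊥
  steinitz {zero} {suc p} _ v b ind v∈b = LinIndep⇒≉0 {B = v} ind zero (proj₂ (v∈b zero))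
  steinitz {suc m} {suc p} (s≤s m<p) v b ind v∈b =
    let (v' , ind' , v'∈) = rank-drop {Y = λ _ → ⊤} (λ _ _ _ → tt) v ind (λ _ → tt) v∈b
    in steinitz m<p v' (b ∘ suc) ind' (proj₁ ∘ v'∈)

  Rank≥⇒nonzero : ∀ {n r} {P : Subset F n} → 0 < r → Rank≥ P r → ∃ λ v → P v × ¬ (∀ j → v j ≈ 0#)
  Rank≥⇒nonzero {r = suc r} _ (B , B-indep , B∈P) = B zero , B∈P zero , LinIndep⇒≉0 {B = B} B-indep zero

  ¬¬-∀-Fin : ∀ {k} {P : Fin k → Set} → (∀ i → ¬ ¬ P i) → ¬ ¬ (∀ i → P i)
  ¬¬-∀-Fin {zero} _ = pure λ ()
  ¬¬-∀-Fin {suc k} h = do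
    p₀ ← h zero
    ps ← ¬¬-∀-Fin (h ∘ suc)
    pure λ where
      zero    → p₀
      (suc i) → ps i

  LinIndep-spans : ∀ {k n} {v b : Fin k → Vect F n} → LinIndep F v → (∀ i → InSpan F b (v i)) →
                   ∀ {z} → InSpan F b z → ¬ ¬ InSpan F v z
  LinIndep-spans {v = v} {b} ind v∈b {z} z∈b z∉v =
    steinitz (ℕₚ.n<1+n _) (z ∷ v) b (LinIndep-∷ {v = v} ind z∉v) λ where
      zero    → z∈b
      (suc i) → v∈b i

  module _ {n k : ℕ} {Z Z' Y : Subset F n} (closed : SubtractionClosed Y)
           (dimZ' : HasDim F Z' (suc k)) (dim∩ : HasDim F (_∩_ F Z Z') k) where

    private
      b = proj₁ dimZ'
      b-indep = proj₁ (proj₂ dimZ')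
      span-b = proj₂ (proj₂ dimZ')
      h = proj₁ dim∩
      h-indep = proj₁ (proj₂ dim∩)
      span-h = proj₂ (proj₂ dim∩)

      h∈Z' : ∀ i → InSpan F b (h i)
      h∈Z' i = Equivalence.to (span-b (h i)) (proj₂ (Equivalence.from (span-h (h i)) (InSpan-basis h i)))

      some-b∉h : ¬ ¬ ∃ λ j → ¬ InSpan F h (b j)
      some-b∉h ¬∃ = ¬¬-∀-Fin (λ j b∉h → ¬∃ (j , b∉h)) (steinitz (ℕₚ.n<1+n k) b h b-indep)

    rank-∩-adjacent : ∀ r → Rank≥ (_∩_ F Z' Y) r → ¬ ¬ Rank≥ (_∩_ F Z Y) (ℕ.pred r)
    rank-∩-adjacent zero _ = pure ((λ ()) , (λ _ _ ()) , λ ())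
    rank-∩-adjacent (suc r) (w , w-indep , w∈) = do
      (j , bj∉h) ← some-b∉h
      w∈bh ← ¬¬-∀-Fin λ i →
        LinIndep-spans {v = b j ∷ h} {b} (LinIndep-∷ {v = h} h-indep bj∉h) (bh∈Z' j)
          (Equivalence.to (span-b (w i)) (proj₁ (w∈ i)))
      let (w' , w'-indep , w'∈) = rank-drop closed w w-indep (proj₂ ∘ w∈) w∈bh
      pure (w' , w'-indep , λ i → proj₁ (Equivalence.from (span-h (w' i)) (proj₁ (w'∈ i))) , proj₂ (w'∈ i))
      where
      bh∈Z' : ∀ j i → InSpan F b ((b j ∷ h) i)
      bh∈Z' j zero = InSpan-basis b j
      bh∈Z' j (suc i) = h∈Z' i

  -- Each step of a walk in the Grassmann graph lowers dim (Z ∩ Y) by at most one.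
  walk-rank : ∀ {n k ℓ} {Z Y : Subset F n} → SubtractionClosed Y →
              CodeWalk F (suc k) Z Y ℓ → HasDim F Z (suc k) → ¬ ¬ Rank≥ (_∩_ F Z Y) (suc k ∸ ℓ)
  walk-rank closed (stop Z≡Y) (B , B-indep , span-B) =
    pure (B , B-indep , λ i → let Bi∈Z = Equivalence.from (span-B (B i)) (InSpan-basis B i)
                              in Bi∈Z , Equivalence.to (Z≡Y (B i)) Bi∈Z)
  walk-rank {k = k} {ℓ = suc ℓ} {Z} {Y} closed (step code adj walk) _ = do
    r ← walk-rank closed walk (proj₁ code)
    ≡.subst (λ t → ¬ ¬ Rank≥ (_∩_ F Z Y) t) (ℕₚ.pred[m∸n]≡m∸[1+n] (suc k) ℓ)
      (rank-∩-adjacent closed (proj₁ code) adj (suc k ∸ ℓ) r)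

  module _ {n : ℕ} where

    SameSubspace-trans : {P Q R : Subset F n} → SameSubspace F P Q → SameSubspace F Q R → SameSubspace F P R
    SameSubspace-trans P≡Q Q≡R v = ⇔.trans (P≡Q v) (Q≡R v)

    HasDim-resp : ∀ {m} {P Q : Subset F n} → SameSubspace F P Q → HasDim F P m → HasDim F Q m
    HasDim-resp P≡Q (B , B-indep , span-B) = B , B-indep , λ v → ⇔.trans (⇔.sym (P≡Q v)) (span-B v)

    IsCode-resp : ∀ {k} {P Q : Subset F n} → SameSubspace F P Q → IsCode F k P → IsCode F k Q
    IsCode-resp P≡Q (dim , nondeg) =
      HasDim-resp P≡Q dim , λ i → let (v , v∈P , vᵢ≉0) = nondeg i in v , Equivalence.to (P≡Q v) v∈P , vᵢ≉0

    ∩-resp : {P P' Q Q' : Subset F n} → SameSubspace F P P' → SameSubspace F Q Q' →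
             SameSubspace F (_∩_ F P Q) (_∩_ F P' Q')
    ∩-resp P≡P' Q≡Q' v = mk⇔ (λ (p , q) → Equivalence.to (P≡P' v) p , Equivalence.to (Q≡Q' v) q)
                             (λ (p , q) → Equivalence.from (P≡P' v) p , Equivalence.from (Q≡Q' v) q)

    CodeWalk-respˡ : ∀ {k ℓ} {X X' Y : Subset F n} → SameSubspace F X X' →
                     CodeWalk F k X Y ℓ → CodeWalk F k X' Y ℓ
    CodeWalk-respˡ X≡X' (stop X≡Y) = stop (SameSubspace-trans (λ v → ⇔.sym (X≡X' v)) X≡Y)
    CodeWalk-respˡ X≡X' (step code adj walk) = step code (HasDim-resp (∩-resp X≡X' (λ _ → ⇔.refl)) adj) walk

    CodeWalk-respʳ : ∀ {k ℓ} {X Y Y' : Subset F n} → SameSubspace F Y Y' →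
                     CodeWalk F k X Y ℓ → CodeWalk F k X Y' ℓ
    CodeWalk-respʳ Y≡Y' (stop X≡Y) = stop (SameSubspace-trans X≡Y Y≡Y')
    CodeWalk-respʳ Y≡Y' (step code adj walk) = step code adj (CodeWalk-respʳ Y≡Y' walk)

    path-walk : ∀ {k} (Z : ℕ → Subset F n) ℓ →
                (∀ i → i < ℓ → IsCode F k (Z (suc i))) → (∀ i → i < ℓ → Adjacent F k (Z i) (Z (suc i))) →
                CodeWalk F k (Z 0) (Z ℓ) ℓ
    path-walk Z zero _ _ = stop (λ _ → ⇔.refl)
    path-walk Z (suc ℓ) code adj =
      step (code 0 (s≤s z≤n)) (adj 0 (s≤s z≤n))
        (path-walk (Z ∘ suc) ℓ (λ i i<ℓ → code (suc i) (s≤s i<ℓ)) (λ i i<ℓ → adj (suc i) (s≤s i<ℓ)))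

  module _ {n : ℕ} where

    InSpan-tail⇒InSpan : ∀ {m} {B : Fin (suc m) → Vect F n} {x} → InSpan F (B ∘ suc) x → InSpan F B x
    InSpan-tail⇒InSpan (c , x≈cB) =
      0# ∷ c , λ j → trans (x≈cB j) (sym (trans (+-cong (zeroˡ _) refl) (+-identityˡ _)))

    InSpan-init⇒InSpan : ∀ {m} {B : Fin (suc m) → Vect F n} {x} → InSpan F (B ∘ inject₁) x → InSpan F B x
    InSpan-init⇒InSpan {B = B} (c , x≈cB) = padLast c , λ j → trans (x≈cB j) (sym (·-padLast c (λ r → B r j)))

    -- The intersection is spanned by the middle s vectors.
    init∩tail-adjacent : ∀ {s} {v : Fin (suc (suc s)) → Vect F n} → LinIndep F v →
                         HasDim F (_∩_ F (InSpan F (v ∘ inject₁)) (InSpan F (v ∘ suc))) s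
    init∩tail-adjacent {s} {v} v-indep =
      v ∘ suc ∘ inject₁ , LinIndep-init {v = v ∘ suc} (LinIndep-tail {v = v} v-indep) ,
      λ x → mk⇔ (into x) λ x∈mid →
        InSpan-tail⇒InSpan {B = v ∘ inject₁} x∈mid , InSpan-init⇒InSpan {B = v ∘ suc} x∈mid
      where
      into : ∀ x → InSpan F (v ∘ inject₁) x × InSpan F (v ∘ suc) x → InSpan F (v ∘ suc ∘ inject₁) x
      into x ((a , x≈av) , (b , x≈bv)) = InSpan-tail {b = v ∘ inject₁} a x≈av a₀≈0
        where
        c : Vect F (suc (suc s))
        c i = padLast a i - (0# ∷ b) i
        cv≈0 : ∀ j → lincomb F c v j ≈ 0#
        cv≈0 j = begin
          c · (λ r → v r j)
            ≈⟨ ·-distribʳ-- (padLast a) (0# ∷ b) (λ r → v r j) ⟩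
          padLast a · (λ r → v r j) - (0# ∷ b) · (λ r → v r j)
            ≈⟨ +-cong (·-padLast a (λ r → v r j)) (-‿cong (+-cong (zeroˡ _) refl)) ⟩
          lincomb F a (v ∘ inject₁) j - (0# + lincomb F b (v ∘ suc) j)
            ≈⟨ +-cong (sym (x≈av j)) (-‿cong (trans (+-identityˡ _) (sym (x≈bv j)))) ⟩
          x j - x j
            ≈⟨ x-x≈0 (x j) ⟩
          0# ∎
        a₀≈0 : a zero ≈ 0#
        a₀≈0 = x-y≈0⇒x≈y (v-indep c cv≈0 zero)

  window : ∀ {n} → (ℕ → Vect F n) → ℕ → (m : ℕ) → Fin m → Vect F n
  window f a m i = f (a ℕ.+ toℕ i)

  module _ {n : ℕ} (f : ℕ → Vect F n) where

    window-init : ∀ a m i j → window f a (suc m) (inject₁ i) j ≈ window f a m i j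
    window-init a m i j = reflexive (≡.cong (λ t → f (a ℕ.+ t) j) (Finₚ.toℕ-inject₁ i))

    window-tail : ∀ a m i j → window f a (suc m) (suc i) j ≈ window f (suc a) m i j
    window-tail a m i j = reflexive (≡.cong (λ t → f t j) (ℕₚ.+-suc a (toℕ i)))

    window-shrinkʳ : ∀ {a m m'} → m ℕ.≤′ m' → LinIndep F (window f a m') → LinIndep F (window f a m)
    window-shrinkʳ ℕ.≤′-refl ind = ind
    window-shrinkʳ {a} {m' = suc m'} (ℕ.≤′-step m≤′m') ind =
      window-shrinkʳ m≤′m' (LinIndep-resp (window-init a m') (LinIndep-init {v = window f a (suc m')} ind))

    window-shrinkˡ : ∀ a {m} → LinIndep F (window f 0 (a ℕ.+ m)) → LinIndep F (window f a m)
    window-shrinkˡ zero ind = ind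
    window-shrinkˡ (suc a) {m} ind =
      LinIndep-resp (window-tail a m) (LinIndep-tail {v = window f a (suc m)}
        (window-shrinkˡ a (≡.subst (LinIndep F ∘ window f 0) (≡.sym (ℕₚ.+-suc a m)) ind)))

    window-indep : ∀ {a m N} → a ℕ.+ m ≤ N → LinIndep F (window f 0 N) → LinIndep F (window f a m)
    window-indep {a} a+m≤N ind = window-shrinkˡ a (window-shrinkʳ (ℕₚ.≤⇒≤′ a+m≤N) ind)

    window-adjacent : ∀ {a s} → LinIndep F (window f a (suc (suc s))) →
                      Adjacent F (suc s) (InSpan F (window f a (suc s))) (InSpan F (window f (suc a) (suc s)))
    window-adjacent {a} {s} ind =
      HasDim-resp (∩-resp (span-resp (window-init a (suc s))) (span-resp (window-tail a (suc s))))
        (init∩tail-adjacent {v = window f a (suc (suc s))} ind)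

module PrimitivePowers {q' : ℕ} (F : FiniteField (suc (suc q'))) (α : FiniteField.Carrier F)
                       (prim : IsPrimitive F α) where

  open FiniteField F hiding (zero)
  open LinearAlgebra F
  open CommutativeSemigroupProperties *-commutativeSemigroup using () renaming (interchange to *-interchange)

  private
    q : ℕ
    q = suc (suc q')
    α≉0 : ¬ α ≈ 0#
    α≉0 = proj₁ prim

  β : Carrier
  β = α ⁻¹

  pow-+ : ∀ x a b → pow F x (a ℕ.+ b) ≈ pow F x a * pow F x b
  pow-+ x zero b = sym (*-identityˡ _)
  pow-+ x (suc a) b = trans (*-cong refl (pow-+ x a b)) (sym (*-assoc _ _ _))

  pow-*-distrib : ∀ x y m → pow F (x * y) m ≈ pow F x m * pow F y m
  pow-*-distrib x y zero = sym (*-identityˡ 1#)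
  pow-*-distrib x y (suc m) = trans (*-cong refl (pow-*-distrib x y m)) (*-interchange x y _ _)

  pow-cong : ∀ {x y} m → x ≈ y → pow F x m ≈ pow F y m
  pow-cong zero _ = refl
  pow-cong (suc m) x≈y = *-cong x≈y (pow-cong m x≈y)

  pow-1# : ∀ m → pow F 1# m ≈ 1#
  pow-1# zero = refl
  pow-1# (suc m) = trans (*-identityˡ _) (pow-1# m)

  pow-≉0 : ∀ {x} → ¬ x ≈ 0# → ∀ m → ¬ pow F x m ≈ 0#
  pow-≉0 x≉0 zero = 1≉0
  pow-≉0 x≉0 (suc m) = x≉0∧y≉0⇒xy≉0 x≉0 (pow-≉0 x≉0 m)

  β≉0 : ¬ β ≈ 0#
  β≉0 = ⁻¹-≉0 α≉0

  nonzero⇒β-power : ∀ {x} → ¬ x ≈ 0# → ∃ λ m → x ≈ pow F β m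
  nonzero⇒β-power {x} x≉0 with proj₂ prim (x ⁻¹) (⁻¹-≉0 x≉0)
  ... | m , x⁻¹≈αᵐ = m , (begin
    x                              ≈⟨ *-identityʳ x ⟨
    x * 1#                         ≈⟨ *-cong refl αᵐβᵐ≈1 ⟨
    x * (pow F α m * pow F β m)    ≈⟨ *-assoc _ _ _ ⟨
    (x * pow F α m) * pow F β m    ≈⟨ *-cong (*-cong refl x⁻¹≈αᵐ) refl ⟨
    (x * x ⁻¹) * pow F β m         ≈⟨ *-cong (⁻¹-inv x x≉0) refl ⟩
    1# * pow F β m                 ≈⟨ *-identityˡ _ ⟩
    pow F β m                      ∎)
    where
    αᵐβᵐ≈1 : pow F α m * pow F β m ≈ 1#
    αᵐβᵐ≈1 = trans (sym (pow-*-distrib α β m)) (trans (pow-cong m (⁻¹-inv α α≉0)) (pow-1# m))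

  private
    index : Carrier → Fin q
    index x = proj₁ (enum-sur x)

    index-injective : ∀ {x y} → index x ≡ index y → x ≈ y
    index-injective {x} {y} eq =
      trans (proj₂ (enum-sur x)) (trans (reflexive (≡.cong enum eq)) (sym (proj₂ (enum-sur y))))

    index-0≢index-βⁱ : ∀ (i : Fin q) → index 0# ≢ index (pow F β (toℕ i))
    index-0≢index-βⁱ i eq = pow-≉0 β≉0 (toℕ i) (sym (index-injective eq))

  -- Pigeonhole on β⁰, …, β^(q-1), which all lie among the q-1 non-zero elements.
  β-period : ∃ λ d → 0 < d × d ≤ suc q' × pow F β d ≈ 1#
  β-period with Finₚ.pigeonhole (ℕₚ.n<1+n (suc q')) (λ i → Fin.punchOut (index-0≢index-βⁱ i))
  ... | i , j , i<j , same-index =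
    toℕ j ∸ toℕ i , ℕₚ.m<n⇒0<n∸m i<j ,
    ℕₚ.≤-trans (ℕₚ.m∸n≤m (toℕ j) (toℕ i)) (ℕₚ.≤-pred (Finₚ.toℕ<n j)) ,
    *-cancelˡ (pow-≉0 β≉0 (toℕ i)) (begin
      pow F β (toℕ i) * pow F β (toℕ j ∸ toℕ i) ≈⟨ pow-+ β (toℕ i) _ ⟨
      pow F β (toℕ i ℕ.+ (toℕ j ∸ toℕ i))       ≡⟨ ≡.cong (pow F β) (ℕₚ.m+[n∸m]≡n (ℕₚ.<⇒≤ i<j)) ⟩
      pow F β (toℕ j)
        ≈⟨ index-injective (Finₚ.punchOut-injective (index-0≢index-βⁱ i) (index-0≢index-βⁱ j) same-index) ⟨
      pow F β (toℕ i)                           ≈⟨ *-identityʳ _ ⟨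
      pow F β (toℕ i) * 1#                      ∎)

  pow-reduce : ∀ {x} d → pow F x (suc d) ≈ 1# → ∀ m → ∃ λ j → j < suc d × pow F x m ≈ pow F x j
  pow-reduce d xᵈ⁺¹≈1 zero = 0 , s≤s z≤n , refl
  pow-reduce d xᵈ⁺¹≈1 (suc m) with pow-reduce d xᵈ⁺¹≈1 m
  ... | j , j<1+d , xᵐ≈xʲ with j ℕ.≟ d
  ...   | yes ≡.refl = 0 , s≤s z≤n , trans (*-cong refl xᵐ≈xʲ) xᵈ⁺¹≈1
  ...   | no j≢d = suc j , s≤s (ℕₚ.≤∧≢⇒< (ℕₚ.≤-pred j<1+d) j≢d) , *-cong refl xᵐ≈xʲ

  nonzero⇒small-β-power : ∀ {x} → ¬ x ≈ 0# → ∃ λ j → j < suc q' × x ≈ pow F β j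
  nonzero⇒small-β-power x≉0 = reduce (nonzero⇒β-power x≉0) β-period
    where
    reduce : ∀ {x} → (∃ λ m → x ≈ pow F β m) → (∃ λ d → 0 < d × d ≤ suc q' × pow F β d ≈ 1#) →
             ∃ λ j → j < suc q' × x ≈ pow F β j
    reduce (m , x≈βᵐ) (suc d , _ , 1+d≤1+q' , βᵈ≈1) =
      let (j , j<1+d , βᵐ≈βʲ) = pow-reduce d βᵈ≈1 m
      in j , ℕₚ.<-≤-trans j<1+d 1+d≤1+q' , trans x≈βᵐ βᵐ≈βʲ

  -- The q+1 coordinates of (y, z) run through all points of the projective line.
  yz-vanishes-somewhere : ∀ A B → ∃ λ p → A * yvec F p + B * zvec F α p ≈ 0#
  yz-vanishes-somewhere A B with B ≈? 0# | A ≈? 0#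
  ... | yes B≈0 | _ = zero , trans (+-cong (zeroʳ A) (trans (*-identityʳ B) B≈0)) (+-identityˡ 0#)
  ... | no _ | yes A≈0 = suc zero , trans (+-cong (trans (*-identityʳ A) A≈0) (zeroʳ B)) (+-identityˡ 0#)
  ... | no B≉0 | no A≉0 = hit (nonzero⇒small-β-power (x≉0∧y≉0⇒xy≉0 A≉0 (⁻¹-≉0 B≉0)))
    where
    hit : (∃ λ j → j < suc q' × A * B ⁻¹ ≈ pow F β j) → ∃ λ p → A * yvec F p + B * zvec F α p ≈ 0#
    hit (j , j<1+q' , A/B≈βʲ) = suc (suc (Fin.fromℕ< j<1+q')) , (begin
      A * 1# + B * - pow F β (toℕ (Fin.fromℕ< j<1+q'))
        ≡⟨ ≡.cong (λ t → A * 1# + B * - pow F β t) (Finₚ.toℕ-fromℕ< j<1+q') ⟩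
      A * 1# + B * - pow F β j       ≈⟨ +-cong (*-identityʳ A) (sym (-‿distribʳ-* B _)) ⟩
      A - B * pow F β j              ≈⟨ +-cong refl (-‿cong (*-cong refl A/B≈βʲ)) ⟨
      A - B * (A * B ⁻¹)             ≈⟨ +-cong refl (-‿cong (trans (*-comm B _) (x/y*y≈x A B≉0))) ⟩
      A - A                          ≈⟨ x-x≈0 A ⟩
      0#                             ∎)

  1yz-independent : ∀ {C A B} → (∀ p → C + (A * yvec F p + B * zvec F α p) ≈ 0#) →
                    C ≈ 0# × A ≈ 0# × B ≈ 0#
  1yz-independent {C} {A} {B} h = C≈0 , A≈0 , B≈0
    where
    C+B≈0 : C + B ≈ 0#
    C+B≈0 = trans (+-cong refl (sym (trans (+-cong (zeroʳ A) (*-identityʳ B)) (+-identityˡ B)))) (h zero)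
    C+A≈0 : C + A ≈ 0#
    C+A≈0 = trans (+-cong refl (sym (trans (+-cong (*-identityʳ A) (zeroʳ B)) (+-identityʳ A)))) (h (suc zero))
    C+A-B≈0 : (C + A) - B ≈ 0#
    C+A-B≈0 = trans (+-assoc C A (- B))
      (trans (+-cong refl (+-cong (sym (*-identityʳ A)) (trans (-‿cong (sym (*-identityʳ B))) (-‿distribʳ-* B 1#))))
             (h (suc (suc zero))))
    B≈0 : B ≈ 0#
    B≈0 = -x≈0⇒x≈0 (trans (sym (+-identityˡ (- B))) (trans (+-cong (sym C+A≈0) refl) C+A-B≈0))
    C≈0 : C ≈ 0#
    C≈0 = trans (sym (+-identityʳ C)) (trans (+-cong refl (sym B≈0)) C+B≈0)
    A≈0 : A ≈ 0#
    A≈0 = trans (sym (+-identityˡ A)) (trans (+-cong (sym C≈0) refl) C+A≈0)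

module Construction {q' : ℕ} (F : FiniteField (suc (suc q'))) (α : FiniteField.Carrier F)
                    (prim : IsPrimitive F α) (k₀ : ℕ)
                    (w : Fin ([ suc (suc (suc k₀)) ] (suc (suc q'))) → Vect F (suc (suc (suc k₀))))
                    (listing : IsListing F (suc (suc (suc k₀))) w) where

  open FiniteField F hiding (zero)
  open LinearAlgebra F
  open PrimitivePowers F α prim

  q k K N : ℕ
  q = suc (suc q')
  k = suc (suc (suc k₀))
  K = [ k ] q
  N = K ℕ.* suc q

  X Y : Subset F N
  X = RowSpace F (GX F k w)
  Y = RowSpace F (GY F k α)

  col : Fin K → Fin (suc q) → Fin N
  col = Fin.combine

  GX-col : ∀ r b p → GX F k w r (col b p) ≡ w b r
  GX-col r b p = ≡.cong (λ bp → w (proj₁ bp) r) (Finₚ.remQuot-combine b p)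

  GY-col : ∀ r b p → GY F k α r (col b p) ≡ GYentry F k α (toℕ r) (toℕ b) p
  GY-col r b p = ≡.cong (λ bp → GYentry F k α (toℕ r) (toℕ (proj₁ bp)) (proj₂ bp)) (Finₚ.remQuot-combine b p)

  -- Block structure of G_Y: in block b (0-indexed) the row min(b, k-2) is y, the next row is z and all
  -- other rows vanish.

  yIndex : ℕ → ℕ
  yIndex b = b ℕ.⊓ suc k₀

  blockEntry : ℕ → ℕ → Fin (suc q) → Carrier
  blockEntry m ρ p = 𝟙[ m ≡ ρ ] * yvec F p + 𝟙[ suc m ≡ ρ ] * zvec F α p

  -- The tests does (m ≟ n) in GYentry compute to m ≡ᵇ n, which `with` cannot abstract; they are decided by
  -- rewriting with dec-true / dec-false instead.
  private
    is-y : ∀ {m ρ} p → m ≡ ρ → yvec F p ≈ blockEntry m ρ p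
    is-y {m} p ≡.refl = sym (begin
      𝟙[ m ≡ m ] * yvec F p + 𝟙[ suc m ≡ m ] * zvec F α p
        ≈⟨ +-cong (*-cong (𝟙-refl m) refl) (*-cong (𝟙-≢ (ℕₚ.1+n≢n {m})) refl) ⟩
      1# * yvec F p + 0# * zvec F α p                    ≈⟨ +-cong (*-identityˡ _) (zeroˡ _) ⟩
      yvec F p + 0#                                      ≈⟨ +-identityʳ _ ⟩
      yvec F p                                           ∎)

    is-z : ∀ {m ρ} p → suc m ≡ ρ → zvec F α p ≈ blockEntry m ρ p
    is-z {m} p ≡.refl = sym (begin
      𝟙[ m ≡ suc m ] * yvec F p + 𝟙[ suc m ≡ suc m ] * zvec F α p
        ≈⟨ +-cong (*-cong (𝟙-≢ (ℕₚ.1+n≢n {m} ∘ ≡.sym)) refl) (*-cong (𝟙-refl (suc m)) refl) ⟩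
      0# * yvec F p + 1# * zvec F α p                    ≈⟨ +-cong (zeroˡ _) (*-identityˡ _) ⟩
      0# + zvec F α p                                    ≈⟨ +-identityˡ _ ⟩
      zvec F α p                                         ∎)

    is-0 : ∀ {m ρ} p → m ≢ ρ → suc m ≢ ρ → 0# ≈ blockEntry m ρ p
    is-0 {m} {ρ} p m≢ρ 1+m≢ρ = sym (begin
      𝟙[ m ≡ ρ ] * yvec F p + 𝟙[ suc m ≡ ρ ] * zvec F α p
        ≈⟨ +-cong (*-cong (𝟙-≢ m≢ρ) refl) (*-cong (𝟙-≢ 1+m≢ρ) refl) ⟩
      0# * yvec F p + 0# * zvec F α p                    ≈⟨ +-cong (zeroˡ _) (zeroˡ _) ⟩
      0# + 0#                                            ≈⟨ +-identityˡ 0# ⟩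
      0#                                                 ∎)

    yIndex≤ : ∀ b → yIndex b ≤ suc k₀
    yIndex≤ b = ℕₚ.m⊓n≤n b (suc k₀)

    yIndex-low : ∀ {b} → b ≤ suc k₀ → yIndex b ≡ b
    yIndex-low = ℕₚ.m≤n⇒m⊓n≡m

    yIndex-high : ∀ {b} → suc k₀ ≤ b → yIndex b ≡ suc k₀
    yIndex-high = ℕₚ.m≥n⇒m⊓n≡n

    yIndex≡k₀+1⇒ : ∀ {b} → yIndex b ≡ suc k₀ → suc k₀ ≤ b
    yIndex≡k₀+1⇒ {b} e = ≡.subst (_≤ b) e (ℕₚ.m⊓n≤m b (suc k₀))

    last-row : ∀ b p → GYentry F k α (suc (suc k₀)) b p ≈ blockEntry (yIndex b) (suc (suc k₀)) p
    last-row b p rewrite dec-true (suc (suc k₀) ℕ.≟ suc (suc k₀)) ≡.refl with suc k₀ ℕ.≤? b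
    ... | yes k₀<b rewrite dec-true (suc k₀ ℕ.≤? b) k₀<b = is-z p (≡.cong suc (yIndex-high k₀<b))
    ... | no k₀≮b rewrite dec-false (suc k₀ ℕ.≤? b) k₀≮b =
      is-0 p (λ e → ℕₚ.1+n≰n (≡.subst (_≤ suc k₀) e (yIndex≤ b)))
             (λ e → k₀≮b (yIndex≡k₀+1⇒ (ℕₚ.suc-injective e)))

    second-last-row : ∀ b p → GYentry F k α (suc k₀) b p ≈ blockEntry (yIndex b) (suc k₀) p
    second-last-row b p
      rewrite dec-false (suc k₀ ℕ.≟ suc (suc k₀)) (ℕₚ.1+n≢n ∘ ≡.sym) | dec-true (suc k₀ ℕ.≟ suc k₀) ≡.refl
      with b ℕ.≟ k₀ | suc k₀ ℕ.≤? b
    ... | yes ≡.refl | _ rewrite dec-true (b ℕ.≟ b) ≡.refl = is-z p (≡.cong suc (yIndex-low (ℕₚ.n≤1+n b)))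
    ... | no b≢k₀ | yes k₀<b rewrite dec-false (b ℕ.≟ k₀) b≢k₀ | dec-true (suc k₀ ℕ.≤? b) k₀<b =
      is-y p (yIndex-high k₀<b)
    ... | no b≢k₀ | no k₀≮b rewrite dec-false (b ℕ.≟ k₀) b≢k₀ | dec-false (suc k₀ ℕ.≤? b) k₀≮b =
      is-0 p (λ e → k₀≮b (yIndex≡k₀+1⇒ e))
             (λ e → b≢k₀ (≡.trans (≡.sym (yIndex-low (ℕₚ.<⇒≤ (ℕₚ.≰⇒> k₀≮b)))) (ℕₚ.suc-injective e)))

    first-row : ∀ b p → GYentry F k α 0 b p ≈ blockEntry (yIndex b) 0 p
    first-row zero p = is-y {0} p ≡.refl
    first-row (suc b) p = is-0 {yIndex (suc b)} {0} p (λ ()) (λ ())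

    middle-row : ∀ ρ b p → 0 < ρ → ρ ≤ k₀ → GYentry F k α ρ b p ≈ blockEntry (yIndex b) ρ p
    middle-row ρ b p 0<ρ ρ≤k₀
      rewrite dec-false (ρ ℕ.≟ suc (suc k₀)) (ℕₚ.<⇒≢ (ℕₚ.m≤n⇒m≤1+n (s≤s ρ≤k₀)))
            | dec-false (ρ ℕ.≟ suc k₀) (ℕₚ.<⇒≢ (s≤s ρ≤k₀))
            | dec-false (ρ ℕ.≟ 0) (ℕₚ.<⇒≢ 0<ρ ∘ ≡.sym)
      with suc b ℕ.≟ ρ | b ℕ.≟ ρ
    ... | yes ≡.refl | _ rewrite dec-true (suc b ℕ.≟ suc b) ≡.refl =
      is-z p (≡.cong suc (yIndex-low (ℕₚ.m≤n⇒m≤1+n (ℕₚ.<⇒≤ ρ≤k₀))))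
    ... | no 1+b≢ρ | yes ≡.refl rewrite dec-false (suc b ℕ.≟ b) ℕₚ.1+n≢n | dec-true (b ℕ.≟ b) ≡.refl =
      is-y p (yIndex-low (ℕₚ.m≤n⇒m≤1+n ρ≤k₀))
    ... | no 1+b≢ρ | no b≢ρ rewrite dec-false (suc b ℕ.≟ ρ) 1+b≢ρ | dec-false (b ℕ.≟ ρ) b≢ρ
      with ℕₚ.≤-total b (suc k₀)
    ...   | inj₁ b≤ rewrite yIndex-low b≤ = is-0 p b≢ρ 1+b≢ρ
    ...   | inj₂ b≥ rewrite yIndex-high b≥ = is-0 p (above ℕₚ.≤-refl) (above (ℕₚ.n≤1+n (suc k₀)))
      where
      above : ∀ {m} → k₀ < m → m ≢ ρ
      above k₀<m m≡ρ = ℕₚ.<⇒≱ k₀<m (≡.subst (_≤ k₀) (≡.sym m≡ρ) ρ≤k₀)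

  GYentry-≈ : ∀ ρ b p → ρ ≤ suc (suc k₀) → GYentry F k α ρ b p ≈ blockEntry (yIndex b) ρ p
  GYentry-≈ zero b p _ = first-row b p
  GYentry-≈ (suc ρ) b p ρ<k with suc ρ ℕ.≟ suc (suc k₀) | suc ρ ℕ.≟ suc k₀
  ... | yes ≡.refl | _ = last-row b p
  ... | no _ | yes ≡.refl = second-last-row b p
  ... | no ρ≢k₀+1 | no ρ≢k₀ = middle-row (suc ρ) b p (s≤s z≤n) (below (below ρ<k ρ≢k₀+1) ρ≢k₀)
    where
    below : ∀ {m n} → m ≤ suc n → m ≢ suc n → m ≤ n
    below m≤1+n m≢1+n = ℕₚ.≤-pred (ℕₚ.≤∧≢⇒< m≤1+n m≢1+n)

  yRow zRow : ℕ → Fin k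
  yRow b = Fin.fromℕ< (s≤s (ℕₚ.m≤n⇒m≤1+n (yIndex≤ b)))
  zRow b = Fin.fromℕ< (s≤s (s≤s (yIndex≤ b)))

  toℕ-yRow : ∀ b → toℕ (yRow b) ≡ yIndex b
  toℕ-yRow b = Finₚ.toℕ-fromℕ< (s≤s (ℕₚ.m≤n⇒m≤1+n (yIndex≤ b)))

  toℕ-zRow : ∀ b → toℕ (zRow b) ≡ suc (yIndex b)
  toℕ-zRow b = Finₚ.toℕ-fromℕ< (s≤s (s≤s (yIndex≤ b)))

  GY-col≈ : ∀ (r : Fin k) b p → GY F k α r (col b p) ≈ blockEntry (yIndex (toℕ b)) (toℕ r) p
  GY-col≈ r b p = trans (reflexive (GY-col r b p)) (GYentry-≈ (toℕ r) (toℕ b) p (ℕₚ.≤-pred (Finₚ.toℕ<n r)))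

  Y-block : ∀ d b p →
            lincomb F d (GY F k α) (col b p) ≈ d (yRow (toℕ b)) * yvec F p + d (zRow (toℕ b)) * zvec F α p
  Y-block d b p = begin
    d · (λ r → GY F k α r (col b p))
      ≈⟨ ·-congʳ d (λ r → GY-col≈ r b p) ⟩
    d · (λ r → 𝟙[ yIndex (toℕ b) ≡ toℕ r ] * yvec F p + 𝟙[ suc (yIndex (toℕ b)) ≡ toℕ r ] * zvec F α p)
      ≈⟨ ·-congʳ d (λ r → reflexive (≡.cong₂ (λ s t → 𝟙[ s ≡ toℕ r ] * yvec F p + 𝟙[ t ≡ toℕ r ] * zvec F α p)
                                             (≡.sym (toℕ-yRow (toℕ b))) (≡.sym (toℕ-zRow (toℕ b))))) ⟩
    d · (λ r → δ (yRow (toℕ b)) r * yvec F p + δ (zRow (toℕ b)) r * zvec F α p)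
      ≈⟨ ·-distribˡ-+ d (λ r → δ (yRow (toℕ b)) r * yvec F p) (λ r → δ (zRow (toℕ b)) r * zvec F α p) ⟩
    d · (λ r → δ (yRow (toℕ b)) r * yvec F p) + d · (λ r → δ (zRow (toℕ b)) r * zvec F α p)
      ≈⟨ +-cong (·-scaleʳ d (δ (yRow (toℕ b))) (yvec F p)) (·-scaleʳ d (δ (zRow (toℕ b))) (zvec F α p)) ⟩
    (d · δ (yRow (toℕ b))) * yvec F p + (d · δ (zRow (toℕ b))) * zvec F α p
      ≈⟨ +-cong (*-cong (·-δ d _) refl) (*-cong (·-δ d _) refl) ⟩
    d (yRow (toℕ b)) * yvec F p + d (zRow (toℕ b)) * zvec F α p ∎

  X-block : ∀ a b p → lincomb F a (GX F k w) (col b p) ≈ a · w b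
  X-block a b p = ·-congʳ a (λ r → reflexive (GX-col r b p))

  k≤K : k ≤ K
  k≤K = n≤[n] k
    where
    n≤[n] : ∀ n → n ≤ [ n ] q
    n≤[n] zero = z≤n
    n≤[n] (suc n) = s≤s (ℕₚ.≤-trans (n≤[n] n) (ℕₚ.m≤n*m ([ n ] q) q))

  block : ∀ t → t < k → Fin K
  block t t<k = Fin.fromℕ< (ℕₚ.<-≤-trans t<k k≤K)

  toℕ-block : ∀ t (t<k : t < k) → toℕ (block t t<k) ≡ t
  toℕ-block t t<k = Finₚ.toℕ-fromℕ< (ℕₚ.<-≤-trans t<k k≤K)

  listed : ∀ v → FirstNonzeroOne F v → ∃ λ b → ∀ s → v s ≈ w b s
  listed = proj₂ (proj₂ listing)

  FirstNonzeroOne-δ : ∀ (t : Fin k) → FirstNonzeroOne F (δ t)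
  FirstNonzeroOne-δ t = t , (λ s s<t → δ-off {i = t} {s} λ t≡s → ℕₚ.<⇒≢ s<t (≡.cong toℕ (≡.sym t≡s))) , δ-diag t

  e₀+e₁ : Vect F k
  e₀+e₁ r = δ zero r + δ (suc zero) r

  FirstNonzeroOne-e₀+e₁ : FirstNonzeroOne F e₀+e₁
  FirstNonzeroOne-e₀+e₁ =
    zero , (λ _ ()) , trans (+-cong (δ-diag {k} zero) (δ-off {k} {suc zero} {zero} λ ())) (+-identityʳ 1#)

  ·-listed : ∀ a v (fz : FirstNonzeroOne F v) → a · w (proj₁ (listed v fz)) ≈ a · v
  ·-listed a v fz = ·-congʳ a (λ s → sym (proj₂ (listed v fz) s))

  core-independence : ∀ a c d → (∀ j → lincomb F a (GX F k w) j + (c * 1# + lincomb F d (GY F k α) j) ≈ 0#) →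
                      (∀ r → a r ≈ 0#) × c ≈ 0# × (∀ r → d r ≈ 0#)
  core-independence a c d h = a≈0 , c≈0 , d≈0
    where
    per-block : ∀ b → a · w b + c * 1# ≈ 0# × d (yRow (toℕ b)) ≈ 0# × d (zRow (toℕ b)) ≈ 0#
    per-block b = 1yz-independent λ p → begin
      (a · w b + c * 1#) + (d (yRow (toℕ b)) * yvec F p + d (zRow (toℕ b)) * zvec F α p)
        ≈⟨ +-assoc _ _ _ ⟩
      a · w b + (c * 1# + (d (yRow (toℕ b)) * yvec F p + d (zRow (toℕ b)) * zvec F α p))
        ≈⟨ +-cong (X-block a b p) (+-cong refl (Y-block d b p)) ⟨
      lincomb F a (GX F k w) (col b p) + (c * 1# + lincomb F d (GY F k α) (col b p))
        ≈⟨ h (col b p) ⟩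
      0# ∎

    -- Row 0 is the y-row of block 0 and row r+1 is the z-row of block r.
    d≈0 : ∀ r → d r ≈ 0#
    d≈0 zero =
      ≡.subst (λ t → d (yRow t) ≈ 0#) (toℕ-block 0 (s≤s z≤n)) (proj₁ (proj₂ (per-block (block 0 (s≤s z≤n)))))
    d≈0 (suc r) = ≡.subst (λ i → d i ≈ 0#) zRow-r
      (≡.subst (λ t → d (zRow t) ≈ 0#) (toℕ-block (toℕ r) r<k) (proj₂ (proj₂ (per-block (block (toℕ r) r<k)))))
      where
      r<k = ℕₚ.m≤n⇒m≤1+n (Finₚ.toℕ<n r)
      zRow-r : zRow (toℕ r) ≡ suc r
      zRow-r = Finₚ.toℕ-injective
        (≡.trans (toℕ-zRow (toℕ r)) (≡.cong suc (yIndex-low (ℕₚ.≤-pred (Finₚ.toℕ<n r)))))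

    a+c≈0 : ∀ v → FirstNonzeroOne F v → a · v + c * 1# ≈ 0#
    a+c≈0 v fz = trans (+-cong (sym (·-listed a v fz)) refl) (proj₁ (per-block (proj₁ (listed v fz))))

    aₜ≈-c : ∀ t → a t ≈ - (c * 1#)
    aₜ≈-c t = x+y≈0⇒x≈-y (trans (+-cong (sym (·-δ a t)) refl) (a+c≈0 (δ t) (FirstNonzeroOne-δ t)))

    c≈0 : c ≈ 0#
    c≈0 = trans (sym (*-identityʳ c)) (-x≈0⇒x≈0 (begin
      - (c * 1#)                                  ≈⟨ +-identityʳ _ ⟨
      - (c * 1#) + 0#                             ≈⟨ +-cong refl (-‿inverseˡ (c * 1#)) ⟨
      - (c * 1#) + (- (c * 1#) + c * 1#)          ≈⟨ +-assoc _ _ _ ⟨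
      (- (c * 1#) + - (c * 1#)) + c * 1#          ≈⟨ +-cong (+-cong (aₜ≈-c zero) (aₜ≈-c (suc zero))) refl ⟨
      (a zero + a (suc zero)) + c * 1#
        ≈⟨ +-cong (trans (·-distribˡ-+ a (δ zero) (δ (suc zero))) (+-cong (·-δ a zero) (·-δ a (suc zero)))) refl ⟨
      a · e₀+e₁ + c * 1#                          ≈⟨ a+c≈0 e₀+e₁ FirstNonzeroOne-e₀+e₁ ⟩
      0#                                          ∎))

    a≈0 : ∀ r → a r ≈ 0#
    a≈0 r = trans (aₜ≈-c r) (trans (-‿cong (trans (*-identityʳ c) c≈0)) -0≈0)

  GX-independent : LinIndep F (GX F k w)
  GX-independent a aX≈0 = proj₁ (core-independence a 0# (λ _ → 0#) λ j →
    trans (+-cong (aX≈0 j) (trans (+-cong (zeroˡ 1#) (·-zeroˡ (λ r → GY F k α r j) (λ _ → refl)))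
                                  (+-identityˡ 0#)))
          (+-identityˡ 0#))

  GY-independent : LinIndep F (GY F k α)
  GY-independent d dY≈0 = proj₂ (proj₂ (core-independence (λ _ → 0#) 0# d λ j →
    trans (+-cong (·-zeroˡ (λ r → GX F k w r j) (λ _ → refl))
                  (trans (+-cong (zeroˡ 1#) (dY≈0 j)) (+-identityˡ 0#)))
          (+-identityˡ 0#)))

  X∩Y≈0 : ∀ v → X v → Y v → ∀ j → v j ≈ 0#
  X∩Y≈0 v (a , v≈aX) (d , v≈dY) j = trans (v≈aX j) (·-zeroˡ (λ r → GX F k w r j) a≈0)
    where
    a≈0 : ∀ r → a r ≈ 0#
    a≈0 = proj₁ (core-independence a 0# (λ r → - d r) λ j → begin
      lincomb F a (GX F k w) j + (0# * 1# + lincomb F (λ r → - d r) (GY F k α) j)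
        ≈⟨ +-cong (sym (v≈aX j)) (trans (+-cong (zeroˡ 1#) (·-negˡ d (λ r → GY F k α r j))) (+-identityˡ _)) ⟩
      v j - lincomb F d (GY F k α) j  ≈⟨ +-cong refl (-‿cong (v≈dY j)) ⟨
      v j - v j                        ≈⟨ x-x≈0 (v j) ⟩
      0#                               ∎)

  X-code : IsCode F k X
  X-code = (GX F k w , GX-independent , λ _ → ⇔.refl) , λ j →
    let b = proj₁ (Fin.remQuot {K} (suc q) j)
        (t , _ , wbt≈1) = proj₁ listing b
    in GX F k w t , InSpan-basis (GX F k w) t , λ GXtj≈0 → 1≉0 (trans (sym wbt≈1) GXtj≈0)

  GY-yRow : ∀ b p → GYentry F k α (toℕ (yRow b)) b p ≈ yvec F p
  GY-yRow b p =
    trans (GYentry-≈ (toℕ (yRow b)) b p (ℕₚ.≤-pred (Finₚ.toℕ<n (yRow b)))) (sym (is-y p (≡.sym (toℕ-yRow b))))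

  GY-zRow : ∀ b p → GYentry F k α (toℕ (zRow b)) b p ≈ zvec F α p
  GY-zRow b p =
    trans (GYentry-≈ (toℕ (zRow b)) b p (ℕₚ.≤-pred (Finₚ.toℕ<n (zRow b)))) (sym (is-z p (≡.sym (toℕ-zRow b))))

  Y-code : IsCode F k Y
  Y-code = (GY F k α , GY-independent , λ _ → ⇔.refl) , λ j →
    let (b , p) = Fin.remQuot {K} (suc q) j
        (r , GYrj≈1) = entry-one (toℕ b) p
    in GY F k α r , InSpan-basis (GY F k α) r , λ GYrj≈0 → 1≉0 (trans (sym GYrj≈1) GYrj≈0)
    where
    entry-one : ∀ b p → ∃ λ r → GYentry F k α (toℕ r) b p ≈ 1#
    entry-one b zero = zRow b , GY-zRow b zero
    entry-one b (suc p) = yRow b , GY-yRow b (suc p)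

  X∩Y-trivial : HasDim F (_∩_ F X Y) 0
  X∩Y-trivial = (λ ()) , (λ _ _ ()) , λ v →
    mk⇔ (λ (v∈X , v∈Y) → (λ ()) , X∩Y≈0 v v∈X v∈Y)
        (λ (_ , v≈0) → InSpan-≈0 (GX F k w) v≈0 , InSpan-≈0 (GY F k α) v≈0)

  -- A walk of length k+1: slide a window of length k along x₁, …, x_k, 1, y₁, …, y_k (then zeros)

  ones : Vect F N
  ones _ = 1#

  ones-then-Y : ℕ → Vect F N
  ones-then-Y = prepend (ones ∷ GY F k α) λ _ _ → 0#

  xy-sequence : ℕ → Vect F N
  xy-sequence = prepend (GX F k w) ones-then-Y

  xy-sequence-X : ∀ i → xy-sequence (toℕ i) ≡ GX F k w i
  xy-sequence-X = prepend-toℕ (GX F k w) ones-then-Y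

  xy-sequence-1Y : ∀ i → xy-sequence (k ℕ.+ toℕ i) ≡ (ones ∷ GY F k α) i
  xy-sequence-1Y i = ≡.trans (prepend-+ (GX F k w) ones-then-Y (toℕ i)) (prepend-toℕ (ones ∷ GY F k α) _ i)

  xy-sequence-ones : xy-sequence k ≡ ones
  xy-sequence-ones = ≡.trans (≡.cong xy-sequence (≡.sym (ℕₚ.+-identityʳ k))) (xy-sequence-1Y zero)

  window₀≈GX : ∀ i j → window xy-sequence 0 k i j ≈ GX F k w i j
  window₀≈GX i j = reflexive (≡.cong (λ v → v j) (xy-sequence-X i))

  windowₖ₊₁≈GY : ∀ i j → window xy-sequence (suc k) k i j ≈ GY F k α i j
  windowₖ₊₁≈GY i j = reflexive (≡.cong (λ v → v j) (≡.trans (≡.cong xy-sequence (≡.sym (ℕₚ.+-suc k (toℕ i))))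
                                                               (xy-sequence-1Y (suc i))))

  xy-sequence-independent : LinIndep F (window xy-sequence 0 (k ℕ.+ suc k))
  xy-sequence-independent c cW≈0 = ↑-cases {k} (λ i → proj₁ zeros i) λ where
      zero    → proj₁ (proj₂ zeros)
      (suc i) → proj₂ (proj₂ zeros) i
    where
    a = c ∘ (_↑ˡ suc k)
    d = c ∘ (k ↑ʳ_) ∘ suc
    zeros = core-independence a (c (k ↑ʳ zero)) d λ j → begin
      a · (λ i → GX F k w i j) + (c (k ↑ʳ zero) * 1# + d · (λ i → GY F k α i j))
        ≈⟨ +-cong (·-congʳ a λ i → reflexive (≡.cong (λ v → v j)
                     (≡.trans (≡.cong xy-sequence (Finₚ.toℕ-↑ˡ i (suc k))) (xy-sequence-X i))))
                  (·-congʳ (c ∘ (k ↑ʳ_)) λ i → reflexive (≡.cong (λ v → v j)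
                     (≡.trans (≡.cong xy-sequence (Finₚ.toℕ-↑ʳ k i)) (xy-sequence-1Y i)))) ⟨
      a · (λ i → xy-sequence (toℕ (i ↑ˡ suc k)) j) + (c ∘ (k ↑ʳ_)) · (λ i → xy-sequence (toℕ (k ↑ʳ i)) j)
        ≈⟨ ·-split k c (λ i → xy-sequence (toℕ i) j) ⟨
      lincomb F c (window xy-sequence 0 (k ℕ.+ suc k)) j
        ≈⟨ cW≈0 j ⟩
      0# ∎

  window-independent : ∀ {a m} → a ℕ.+ m ≤ k ℕ.+ suc k → LinIndep F (window xy-sequence a m)
  window-independent a+m≤ = window-indep xy-sequence a+m≤ xy-sequence-independent

  Z : ℕ → Subset F N
  Z a = InSpan F (window xy-sequence a k)

  Z-code : ∀ a → 0 < a → a ≤ k → IsCode F k (Z a)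
  Z-code a 0<a a≤k =
    (window xy-sequence a k , window-independent {a} {k} a+k≤ , λ _ → ⇔.refl) ,
    λ j → window xy-sequence a k i₁ , InSpan-basis (window xy-sequence a k) i₁ ,
          λ i₁ⱼ≈0 → 1≉0 (trans (reflexive (≡.cong (λ v → v j) (≡.sym i₁-is-ones))) i₁ⱼ≈0)
    where
    a+k≤ : a ℕ.+ k ≤ k ℕ.+ suc k
    a+k≤ = ℕₚ.≤-trans (ℕₚ.+-monoˡ-≤ k (ℕₚ.m≤n⇒m≤1+n a≤k)) (ℕₚ.≤-reflexive (ℕₚ.+-comm (suc k) k))
    i₁ : Fin k
    i₁ = Fin.fromℕ< (ℕₚ.∸-monoʳ-< 0<a a≤k)
    i₁-is-ones : window xy-sequence a k i₁ ≡ ones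
    i₁-is-ones = ≡.trans (≡.cong (λ t → xy-sequence (a ℕ.+ t)) (Finₚ.toℕ-fromℕ< _))
                         (≡.trans (≡.cong xy-sequence (ℕₚ.m+[n∸m]≡n a≤k)) xy-sequence-ones)

  Z-adjacent : ∀ a → a ≤ k → Adjacent F k (Z a) (Z (suc a))
  Z-adjacent a a≤k =
    window-adjacent xy-sequence {a} {suc (suc k₀)} (window-independent {a} {suc k} (ℕₚ.+-monoˡ-≤ (suc k) a≤k))

  Z₀≡X : SameSubspace F (Z 0) X
  Z₀≡X = span-resp {B = window xy-sequence 0 k} {B' = GX F k w} window₀≈GX

  Zₖ₊₁≡Y : SameSubspace F (Z (suc k)) Y
  Zₖ₊₁≡Y = span-resp {B = window xy-sequence (suc k) k} {B' = GY F k α} windowₖ₊₁≈GY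

  walk : CodeWalk F k X Y (suc k)
  walk = CodeWalk-respˡ Z₀≡X (CodeWalk-respʳ Zₖ₊₁≡Y (path-walk Z (suc k) code adjacent))
    where
    adjacent : ∀ i → i < suc k → Adjacent F k (Z i) (Z (suc i))
    adjacent i i<1+k = Z-adjacent i (ℕₚ.≤-pred i<1+k)
    code : ∀ i → i < suc k → IsCode F k (Z (suc i))
    code i i<1+k = [ Z-code (suc i) (s≤s z≤n) , (λ { ≡.refl → IsCode-resp (λ v → ⇔.sym (Zₖ₊₁≡Y v)) Y-code }) ]′
                     (ℕₚ.m≤n⇒m<n∨m≡n (ℕₚ.≤-pred i<1+k))

  -- No walk of length at most k

  Y-closed : SubtractionClosed Y
  Y-closed μ = InSpan-sub {B = GY F k α} μ

  Y-vanishes-in-block : ∀ {v} → Y v → ∀ b → ∃ λ p → v (col b p) ≈ 0#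
  Y-vanishes-in-block (d , v≈dY) b =
    let (p , e) = yz-vanishes-somewhere (d (yRow (toℕ b))) (d (zRow (toℕ b)))
    in p , trans (v≈dY (col b p)) (trans (Y-block d b p) e)

  -- Up to scaling a non-zero c is some w_b, and on block b each hᵢ = Σ_r uᵢ r x_r equals c · uᵢ up to that scalar.
  X-vanishes-in-block : ∀ {m} (h : Fin m → Vect F N) (u : Fin m → Vect F k) →
                        (∀ i j → h i j ≈ lincomb F (u i) (GX F k w) j) →
                        (c : Vect F k) → (∃ λ r → ¬ c r ≈ 0#) → (∀ i → c · u i ≈ 0#) →
                        ∃ λ b → ∀ i p → h i (col b p) ≈ 0#
  X-vanishes-in-block h u h≈uX c c≉0 c·u≈0 = b , λ i p → begin
    h i (col b p)                         ≈⟨ h≈uX i (col b p) ⟩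
    lincomb F (u i) (GX F k w) (col b p)  ≈⟨ X-block (u i) b p ⟩
    u i · w b                             ≈⟨ ·-congʳ (u i) (λ s → sym (proj₂ (listed c' c'-normal) s)) ⟩
    u i · c'                              ≈⟨ ·-comm (u i) c' ⟩
    c' · u i                              ≈⟨ ·-scaleˡ (c t ⁻¹) c (u i) ⟩
    c t ⁻¹ * (c · u i)                    ≈⟨ *-cong refl (c·u≈0 i) ⟩
    c t ⁻¹ * 0#                           ≈⟨ zeroʳ _ ⟩
    0#                                    ∎
    where
    t = proj₁ (first-nonzero c c≉0)
    before-t = proj₁ (proj₂ (first-nonzero c c≉0))
    cₜ≉0 = proj₂ (proj₂ (first-nonzero c c≉0))
    c' : Vect F k
    c' r = c t ⁻¹ * c r
    c'-normal : FirstNonzeroOne F c'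
    c'-normal = t , (λ s s<t → trans (*-cong refl (before-t s s<t)) (zeroʳ _)) , ⁻¹-inverseˡ cₜ≉0
    b = proj₁ (listed c' c'-normal)

  common-zero⇒⊥ : ∀ {Z} → IsCode F k Z → (g : Fin k → Vect F N) → LinIndep F g → (∀ i → Z (g i)) →
                  ∀ j → (∀ i → g i j ≈ 0#) → ⊥
  common-zero⇒⊥ ((B , _ , span-B) , nondeg) g g-indep g∈Z j gⱼ≈0 =
    let (z , z∈Z , zⱼ≉0) = nondeg j in
    LinIndep-spans {v = g} {B} g-indep (λ i → Equivalence.to (span-B (g i)) (g∈Z i)) (Equivalence.to (span-B z) z∈Z)
      λ (c , z≈cg) → zⱼ≉0 (trans (z≈cg j) (·-zeroʳ c gⱼ≈0))

  -- The k coefficient columns of a basis of X ∩ Z₁ over the rows of G_X lie in F^(k-1); a dependency selects a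
  -- block on which X ∩ Z₁ vanishes, v vanishes somewhere in that block, and v with X ∩ Z₁ spans Z₁.
  adjacent-code∩Y-trivial : ∀ {Z₁} → IsCode F k Z₁ → Adjacent F k X Z₁ →
                            ∀ {v} → Z₁ v → Y v → ¬ (∀ j → v j ≈ 0#) → ⊥
  adjacent-code∩Y-trivial {Z₁} code (h , h-indep , span-h) {v} v∈Z₁ v∈Y v≉0 =
    steinitz (ℕₚ.n<1+n (suc (suc k₀))) cols δ cols-indep (λ r → InSpan-standard (cols r))
    where
    h∈X : ∀ i → X (h i)
    h∈X i = proj₁ (Equivalence.from (span-h (h i)) (InSpan-basis h i))
    h∈Z₁ : ∀ i → Z₁ (h i)
    h∈Z₁ i = proj₂ (Equivalence.from (span-h (h i)) (InSpan-basis h i))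
    u : Fin (suc (suc k₀)) → Vect F k
    u i = proj₁ (h∈X i)
    cols : Fin k → Vect F (suc (suc k₀))
    cols r i = u i r
    v∉h : ¬ InSpan F h v
    v∉h v∈h = v≉0 (X∩Y≈0 v (proj₁ (Equivalence.from (span-h v) v∈h)) v∈Y)
    cols-indep : LinIndep F cols
    cols-indep c c·cols≈0 r with c r ≈? 0#
    ... | yes cᵣ≈0 = cᵣ≈0
    ... | no cᵣ≉0 =
      let (b , h-vanish) = X-vanishes-in-block h u (λ i → proj₂ (h∈X i)) c (r , cᵣ≉0) c·cols≈0
          (p , vₚ≈0) = Y-vanishes-in-block v∈Y b
      in ⊥-elim (common-zero⇒⊥ code (v ∷ h) (LinIndep-∷ {v = h} h-indep v∉h) v∷h∈Z₁ (col b p) λ where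
           zero    → vₚ≈0
           (suc i) → h-vanish i p)
      where
      v∷h∈Z₁ : ∀ i → Z₁ ((v ∷ h) i)
      v∷h∈Z₁ zero = v∈Z₁
      v∷h∈Z₁ (suc i) = h∈Z₁ i

  no-shorter-walk : ∀ ℓ → ℓ < suc k → ¬ CodeWalk F k X Y ℓ
  no-shorter-walk zero _ (stop X≡Y) =
    LinIndep⇒≉0 {B = GX F k w} GX-independent zero (X∩Y≈0 _ x₀∈X (Equivalence.to (X≡Y _) x₀∈X))
    where x₀∈X = InSpan-basis (GX F k w) zero
  no-shorter-walk (suc ℓ) (s≤s ℓ<k) (step {Z = Z₁} code adj walk) =
    walk-rank Y-closed walk (proj₁ code) λ rank →
      let (v , (v∈Z₁ , v∈Y) , v≉0) = Rank≥⇒nonzero {P = _∩_ F Z₁ Y} (ℕₚ.m<n⇒0<n∸m ℓ<k) rank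
      in adjacent-code∩Y-trivial code adj v∈Z₁ v∈Y v≉0

  distances : IsCode F k X × IsCode F k Y × GrassDist F k X Y k × CodeDist F k X Y (suc k)
  distances = X-code , Y-code , (0 , X∩Y-trivial , ℕₚ.+-identityʳ k) , walk , no-shorter-walk

¬FiniteField-0 : ¬ FiniteField 0
¬FiniteField-0 F with FiniteField.enum-sur F (FiniteField.0# F)
... | () , _

¬FiniteField-1 : ¬ FiniteField 1
¬FiniteField-1 F = 0≉1 (trans (≈enum₀ 0#) (sym (≈enum₀ 1#)))
  where
  open FiniteField F hiding (zero)
  ≈enum₀ : ∀ x → x ≈ enum zero
  ≈enum₀ x with enum-sur x
  ... | zero , x≈e = x≈e

lemma4 : (q : ℕ) (F : FiniteField q) (α : FiniteField.Carrier F) → IsPrimitive F α →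
         (k : ℕ) → 2 < k →
         (w : Fin ([ k ] q) → Vect F k) → IsListing F k w →
         IsCode F k (RowSpace F (GX F k w)) × IsCode F k (RowSpace F (GY F k α))
         × GrassDist F k (RowSpace F (GX F k w)) (RowSpace F (GY F k α)) k
         × CodeDist F k (RowSpace F (GX F k w)) (RowSpace F (GY F k α)) (suc k)
lemma4 zero F _ _ _ _ _ _ = ⊥-elim (¬FiniteField-0 F)
lemma4 (suc zero) F _ _ _ _ _ _ = ⊥-elim (¬FiniteField-1 F)
lemma4 (suc (suc q')) F α prim (suc (suc (suc k₀))) (s≤s (s≤s (s≤s _))) w listing =
  Construction.distances F α prim k₀ w listing
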